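{- Let $(V_I)$ be any basis of $\mathrm{Sym}$, indexed by compositions, whose coproduct is the unshuffle of compositions, i.e. $\Delta V_I=\sum_{K,L}\langle I\mid K\,\sqcup\!\sqcup\, L\rangle V_K\otimes V_L$ (for example a multiplicative basis $P^I=P_{i_1}\cdots P_{i_r}$ built from a sequence of primitive generators $P_n$ of $\mathrm{Sym}$, such as $\Psi^I$ or $\Phi^I$). For compositions $I,J$ let $c_{IJ}$ be the number of set partitions $\pi$ of $[n]$ with $K(\pi)=I$ and $C(\pi)=J$ (zero unless $I,J$ are compositions of the same $n$ with the same length), and let $X_J=\sum_I c_{IJ}V_I$. Then the basis $(Z_I)$ of $\mathrm{QSym}$ dual to $(X_J)$ satisfies $Z_IZ_J=\sum_K\langle W_K\mid W_I\,\sqcup\!\sqcup\, W_J\rangle Z_K$ for all compositions $I,J$.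
   Context: $\mathbb{K}$ is a field of characteristic $0$; $\mathrm{Sym}$ (noncommutative symmetric functions) and $\mathrm{QSym}$ (quasi-symmetric functions) are graded dual Hopf algebras, and dual bases refer to this pairing. In $\langle I\mid K\,\sqcup\!\sqcup\, L\rangle$, compositions are regarded as words over the alphabet of positive integers and $\sqcup\!\sqcup$ is the shuffle of words; $\langle w\mid P\rangle$ is the coefficient of the word $w$ in $P$. For a set partition $\pi$ of $[n]$ with blocks ordered by increasing maximal elements $m_1<\dots<m_k=n$, $C(\pi)=(m_1,m_2-m_1,\dots,m_k-m_{k-1})$ and $K(\pi)$ is the sequence of block sizes in that order. For a composition $I=(i_1,\dots,i_r)$, $W_I=a^{i_1-1}b\cdots a^{i_r-1}b$ is a word over $\{a,b\}$. -}

module Defs where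

open import Level using (Level)
import Data.Nat
open import Data.Nat using (ℕ; zero; suc; _∸_; _⊔_; _<_; _≟_)
open import Data.Bool using (Bool; true; false)
open import Data.List using (List; []; _∷_; _++_; map; concatMap; filter; length; foldr; upTo; replicate)
open import Data.Nat.ListAction using (sum)
open import Data.List.Properties using (≡-dec)
open import Data.List.Relation.Unary.All using (All)
open import Data.Product using (_×_; _,_)
open import Relation.Nullary.Decidable using (_×-dec_)
open import Relation.Binary.PropositionalEquality using (_≡_)
open import Algebra.Bundles using (CommutativeRing)

Composition : Set
Composition = List ℕ

IsComposition : Composition → Set
IsComposition I = All (0 <_) I

size : Composition → ℕ
size = sum

-- all compositions of n (each exactly once)
private
  step : Composition → List Composition
  step []      = (1 ∷ []) ∷ []
  step (k ∷ c) = (1 ∷ k ∷ c) ∷ (suc k ∷ c) ∷ []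

compositions : ℕ → List Composition
compositions zero    = [] ∷ []
compositions (suc n) = concatMap step (compositions n)

-- Shuffle of words (as a list of words, with multiplicity)

shuffle : {A : Set} → List A → List A → List (List A)
shuffle []       ys       = ys ∷ []
shuffle (x ∷ xs) []       = (x ∷ xs) ∷ []
shuffle (x ∷ xs) (y ∷ ys) =
  map (x ∷_) (shuffle xs (y ∷ ys)) ++ map (y ∷_) (shuffle (x ∷ xs) ys)

coeff : {A : Set} → (∀ (a b : A) → Relation.Nullary.Decidable.Dec (a ≡ b)) →
        List A → List (List A) → ℕ
coeff eq w P = length (filter (≡-dec eq w) P)

shCoeffComp : Composition → Composition → Composition → ℕ
shCoeffComp I K L = coeff _≟_ I (shuffle K L)

a b : Bool
a = false
b = true

_≟B_ : (x y : Bool) → Relation.Nullary.Decidable.Dec (x ≡ y)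
_≟B_ = Data.Bool._≟_

W : Composition → List Bool
W []      = []
W (i ∷ I) = replicate (i ∸ 1) a ++ (b ∷ W I)

abCoeff : Composition → Composition → Composition → ℕ
abCoeff K I J = coeff _≟B_ (W K) (shuffle (W I) (W J))

-- Each set partition is generated exactly once: element n+1 is either
-- added to one of the existing blocks or put in a new singleton block.

SetPartition : Set
SetPartition = List (List ℕ)

private
  ins : ℕ → SetPartition → List SetPartition
  ins x []      = ((x ∷ []) ∷ []) ∷ []
  ins x (B ∷ π) = ((x ∷ B) ∷ π) ∷ map (B ∷_) (ins x π)

setPartitions : ℕ → List SetPartition
setPartitions zero    = [] ∷ []
setPartitions (suc n) = concatMap (ins (suc n)) (setPartitions n)

maxB : List ℕ → ℕ
maxB = foldr _⊔_ 0

orderedBlocks : ℕ → SetPartition → List (List ℕ)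
orderedBlocks n π = concatMap (λ m → filter (λ B → maxB B ≟ m) π) (map suc (upTo n))

private
  diffs : ℕ → List ℕ → List ℕ
  diffs prev []       = []
  diffs prev (m ∷ ms) = (m ∸ prev) ∷ diffs m ms

Cπ : ℕ → SetPartition → Composition
Cπ n π = diffs 0 (map maxB (orderedBlocks n π))

Kπ : ℕ → SetPartition → Composition
Kπ n π = map length (orderedBlocks n π)

cIJ : Composition → Composition → ℕ
cIJ I J = length (filter (λ π → ≡-dec _≟_ (Kπ n π) I ×-dec ≡-dec _≟_ (Cπ n π) J)
                         (setPartitions n))
  where n = size I

module _ {c ℓ} (R : CommutativeRing c ℓ) where
  open CommutativeRing R using (Carrier; 0#; 1#; _+_)

  fromℕ : ℕ → Carrier
  fromℕ zero    = 0#
  fromℕ (suc n) = 1# + fromℕ n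

  Σ[_]_ : {A : Set} → List A → (A → Carrier) → Carrier
  Σ[ xs ] f = foldr (λ x s → f x + s) 0# xs

size₂ : Composition → Composition → ℕ
size₂ I J = Data.Nat._+_ (size I) (size J)

module Submission where

open import Defs
open import Data.Nat using (ℕ; suc)
open import Data.Product using (∃)
open import Algebra.Bundles using (CommutativeRing; CommutativeSemiring)

-- c_{IJ} is the weight ways 0 I (W_J) of an automaton that reads W_J as the elements
-- 1, …, n of a set partition, a b closing a block whose other elements are chosen
-- among the elements still open.  These weights respect shuffles: summing the weight of
-- W_R over K ∈ I ⧢ J splits the open elements between I and J, which amounts to
-- deshuffling W_R.  Hence, in ℕ,
--   Σ_K ⟨K | I ⧢ J⟩ c_{KR} = Σ_{P,Q} c_{IP} c_{JQ} ⟨W_R | W_P ⧢ W_Q⟩,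
-- so expanding V*_I V*_J in the Z basis in two ways shows that the defects
-- Z_P Z_Q − Σ_R ⟨W_R | W_P ⧢ W_Q⟩ Z_R satisfy Σ_{P,Q} c_{IP} c_{JQ} (defect P Q) = 0.
-- As c is unitriangular for the sum of partial sums, all defects vanish by downward
-- induction.

module ListSum {c ℓ} (S : CommutativeSemiring c ℓ) where

  open import Data.List using (List; []; _∷_; _++_; map; concatMap; foldr)
  open import Data.List.Relation.Unary.All using (All; []; _∷_)
  open CommutativeSemiring S
  open import Algebra.Properties.CommutativeSemigroup +-commutativeSemigroup using () renaming (interchange to +-interchange)

  private variable
    A B : Set

  ∑ : List A → (A → Carrier) → Carrier
  ∑ xs f = foldr (λ x s → f x + s) 0# xs

  ∑-cong : (xs : List A) {f g : A → Carrier} → (∀ x → f x ≈ g x) → ∑ xs f ≈ ∑ xs g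
  ∑-cong []       f≈g = refl
  ∑-cong (x ∷ xs) f≈g = +-cong (f≈g x) (∑-cong xs f≈g)

  ∑-congᴬ : (xs : List A) {f g : A → Carrier} → All (λ x → f x ≈ g x) xs → ∑ xs f ≈ ∑ xs g
  ∑-congᴬ []       []           = refl
  ∑-congᴬ (x ∷ xs) (fx≈gx ∷ ps) = +-cong fx≈gx (∑-congᴬ xs ps)

  ∑-zero : (xs : List A) {f : A → Carrier} → (∀ x → f x ≈ 0#) → ∑ xs f ≈ 0#
  ∑-zero []       f≈0 = refl
  ∑-zero (x ∷ xs) f≈0 = trans (+-cong (f≈0 x) (∑-zero xs f≈0)) (+-identityˡ 0#)

  ∑-zeroᴬ : (xs : List A) {f : A → Carrier} → All (λ x → f x ≈ 0#) xs → ∑ xs f ≈ 0#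
  ∑-zeroᴬ []       []          = refl
  ∑-zeroᴬ (x ∷ xs) (fx≈0 ∷ ps) = trans (+-cong fx≈0 (∑-zeroᴬ xs ps)) (+-identityˡ 0#)

  ∑-++ : (xs ys : List A) (f : A → Carrier) → ∑ (xs ++ ys) f ≈ ∑ xs f + ∑ ys f
  ∑-++ []       ys f = sym (+-identityˡ _)
  ∑-++ (x ∷ xs) ys f = trans (+-congˡ (∑-++ xs ys f)) (sym (+-assoc (f x) _ _))

  ∑-map : (g : A → B) (xs : List A) (f : B → Carrier) → ∑ (map g xs) f ≈ ∑ xs (λ x → f (g x))
  ∑-map g []       f = refl
  ∑-map g (x ∷ xs) f = +-congˡ (∑-map g xs f)

  ∑-concatMap : (g : A → List B) (xs : List A) (f : B → Carrier) →
                ∑ (concatMap g xs) f ≈ ∑ xs (λ x → ∑ (g x) f)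
  ∑-concatMap g []       f = refl
  ∑-concatMap g (x ∷ xs) f = trans (∑-++ (g x) (concatMap g xs) f) (+-congˡ (∑-concatMap g xs f))

  ∑-+ : (xs : List A) (f g : A → Carrier) → ∑ xs (λ x → f x + g x) ≈ ∑ xs f + ∑ xs g
  ∑-+ []       f g = sym (+-identityˡ 0#)
  ∑-+ (x ∷ xs) f g = trans (+-congˡ (∑-+ xs f g)) (+-interchange (f x) (g x) (∑ xs f) (∑ xs g))

  ∑-*ˡ : (xs : List A) (k : Carrier) (f : A → Carrier) → ∑ xs (λ x → k * f x) ≈ k * ∑ xs f
  ∑-*ˡ []       k f = sym (zeroʳ k)
  ∑-*ˡ (x ∷ xs) k f = trans (+-congˡ (∑-*ˡ xs k f)) (sym (distribˡ k (f x) _))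

  ∑-*ʳ : (xs : List A) (k : Carrier) (f : A → Carrier) → ∑ xs (λ x → f x * k) ≈ ∑ xs f * k
  ∑-*ʳ xs k f = trans (∑-cong xs (λ x → *-comm (f x) k)) (trans (∑-*ˡ xs k f) (*-comm k _))

  ∑-swap : (xs : List A) (ys : List B) (f : A → B → Carrier) →
           ∑ xs (λ x → ∑ ys (f x)) ≈ ∑ ys (λ y → ∑ xs (λ x → f x y))
  ∑-swap []       ys f = sym (∑-zero ys (λ _ → refl))
  ∑-swap (x ∷ xs) ys f = trans (+-congˡ (∑-swap xs ys f)) (sym (∑-+ ys (f x) _))

  ∑-*-∑ : (xs : List A) (ys : List B) (f : A → Carrier) (g : B → Carrier) →
          ∑ xs f * ∑ ys g ≈ ∑ xs (λ x → ∑ ys (λ y → f x * g y))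
  ∑-*-∑ xs ys f g =
    trans (sym (∑-*ʳ xs (∑ ys g) f)) (∑-cong xs (λ x → sym (∑-*ˡ ys (f x) g)))

module Counting where

  open import Data.Nat using (ℕ; zero; suc; _+_; _*_; _∸_; _≤_; _<_; z≤n; s≤s; s≤s⁻¹; pred; _≟_; _≤?_; _!)
  open import Data.Nat.Properties
  open import Data.Nat.Tactic.RingSolver using (solve-∀)
  open import Algebra.Properties.CommutativeSemigroup +-commutativeSemigroup
    using () renaming (interchange to +-interchange; x∙yz≈y∙xz to x+[y+z]≡y+[x+z])
  open import Algebra.Properties.CommutativeSemigroup *-commutativeSemigroup
    using () renaming (x∙yz≈y∙xz to x*[y*z]≡y*[x*z])
  open import Data.Bool using (Bool; true; false)
  open import Data.List using (List; []; _∷_; _++_; map; concatMap; concat; filter; length; replicate; upTo; applyUpTo; initLast; _∷ʳ′_)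
  open import Data.List.Properties
    using (≡-dec; ∷-injective; length-++; length-replicate; map-cong-local; map-++; length-map;
           filter-++; filter-accept; filter-reject; ++-identityʳ)
  open import Data.List.Relation.Unary.All using (All; []; _∷_)
  import Data.List.Relation.Unary.All as All
  import Data.List.Relation.Unary.All.Properties as Allₚ
  open import Data.Product using (Σ; _×_; _,_; proj₁; proj₂)
  open import Data.Empty using (⊥-elim)
  open import Data.Sum using (_⊎_; inj₁; inj₂)
  open import Function using (_∘_)
  open import Relation.Nullary using (Dec; yes; no; _because_; ¬_; _×-dec_)
  open import Relation.Unary using (Decidable)
  open import Relation.Binary.Definitions using (DecidableEquality)
  open import Relation.Binary.PropositionalEquality
  open ≡-Reasoning
  open ListSum +-*-commutativeSemiring

  ⟦_⟧ : {P : Set} → Dec P → ℕ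
  ⟦ true  because _ ⟧ = 1
  ⟦ false because _ ⟧ = 0

  ⟦⟧-yes : {P : Set} (d : Dec P) → P → ⟦ d ⟧ ≡ 1
  ⟦⟧-yes (yes _) p = refl
  ⟦⟧-yes (no ¬p) p = ⊥-elim (¬p p)

  ⟦⟧-no : {P : Set} (d : Dec P) → ¬ P → ⟦ d ⟧ ≡ 0
  ⟦⟧-no (yes p) ¬p = ⊥-elim (¬p p)
  ⟦⟧-no (no _)  ¬p = refl

  ⟦⟧-⇔ : {P Q : Set} (d : Dec P) (e : Dec Q) → (P → Q) → (Q → P) → ⟦ d ⟧ ≡ ⟦ e ⟧
  ⟦⟧-⇔ (yes p) e to from = sym (⟦⟧-yes e (to p))
  ⟦⟧-⇔ (no ¬p) e to from = sym (⟦⟧-no e (λ q → ¬p (from q)))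

  length-filter≡∑⟦⟧ : {A : Set} {P : A → Set} (P? : Decidable P) (xs : List A) →
                      length (filter P? xs) ≡ ∑ xs (λ x → ⟦ P? x ⟧)
  length-filter≡∑⟦⟧ P? []       = refl
  length-filter≡∑⟦⟧ P? (x ∷ xs) with P? x
  ... | true  because _ = cong suc (length-filter≡∑⟦⟧ P? xs)
  ... | false because _ = length-filter≡∑⟦⟧ P? xs

  module _ {A : Set} (_≟ᴬ_ : DecidableEquality A) where

    ⟦⟧-sym : ∀ x y → ⟦ x ≟ᴬ y ⟧ ≡ ⟦ y ≟ᴬ x ⟧
    ⟦⟧-sym x y = ⟦⟧-⇔ (x ≟ᴬ y) (y ≟ᴬ x) sym sym

    ⟦⟧-∷ : ∀ x y xs ys → ⟦ ≡-dec _≟ᴬ_ (x ∷ xs) (y ∷ ys) ⟧ ≡ ⟦ x ≟ᴬ y ⟧ * ⟦ ≡-dec _≟ᴬ_ xs ys ⟧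
    ⟦⟧-∷ x y xs ys = go (x ≟ᴬ y) (≡-dec _≟ᴬ_ xs ys)
      where
      go : (d : Dec (x ≡ y)) (e : Dec (xs ≡ ys)) → ⟦ ≡-dec _≟ᴬ_ (x ∷ xs) (y ∷ ys) ⟧ ≡ ⟦ d ⟧ * ⟦ e ⟧
      go (no x≢y)   _           = ⟦⟧-no (≡-dec _≟ᴬ_ (x ∷ xs) (y ∷ ys)) (x≢y ∘ proj₁ ∘ ∷-injective)
      go (yes refl) (no xs≢ys)  = ⟦⟧-no (≡-dec _≟ᴬ_ (x ∷ xs) (y ∷ ys)) (xs≢ys ∘ proj₂ ∘ ∷-injective)
      go (yes refl) (yes refl)  = ⟦⟧-yes (≡-dec _≟ᴬ_ (x ∷ xs) (x ∷ xs)) refl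

    ⟦≟⟧-*-subst : ∀ (h : A → ℕ) x y → ⟦ x ≟ᴬ y ⟧ * h x ≡ ⟦ y ≟ᴬ x ⟧ * h y
    ⟦≟⟧-*-subst h x y with x ≟ᴬ y
    ... | yes refl = cong (_* h x) (sym (⟦⟧-yes (x ≟ᴬ x) refl))
    ... | no x≢y   = cong (_* h y) (sym (⟦⟧-no (y ≟ᴬ x) (x≢y ∘ sym)))

    count : A → List A → ℕ
    count w xs = ∑ xs (λ x → ⟦ w ≟ᴬ x ⟧)

    ∑-count-swap : (X S : List A) (g : A → ℕ) →
                   ∑ X (λ x → count x S * g x) ≡ ∑ S (λ s → count s X * g s)
    ∑-count-swap X S g = begin
      ∑ X (λ x → count x S * g x)                ≡⟨ ∑-cong X (λ x → sym (∑-*ʳ S (g x) _)) ⟩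
      ∑ X (λ x → ∑ S (λ s → ⟦ x ≟ᴬ s ⟧ * g x))  ≡⟨ ∑-swap X S _ ⟩
      ∑ S (λ s → ∑ X (λ x → ⟦ x ≟ᴬ s ⟧ * g x))  ≡⟨ ∑-cong S (λ s → ∑-cong X (λ x → ⟦≟⟧-*-subst g x s)) ⟩
      ∑ S (λ s → ∑ X (λ x → ⟦ s ≟ᴬ x ⟧ * g s))  ≡⟨ ∑-cong S (λ s → ∑-*ʳ X (g s) _) ⟩
      ∑ S (λ s → count s X * g s)                ∎

    ∑-count-enumeration : (X S : List A) (g : A → ℕ) → All (λ s → count s X ≡ 1) S →
                          ∑ X (λ x → count x S * g x) ≡ ∑ S g
    ∑-count-enumeration X S g once =
      trans (∑-count-swap X S g) (∑-congᴬ S (go once))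
      where
      go : ∀ {S} → All (λ s → count s X ≡ 1) S → All (λ s → count s X * g s ≡ g s) S
      go []           = []
      go (c≡1 ∷ once) = trans (cong (_* g _) c≡1) (*-identityˡ _) ∷ go once

  -- Pascal's recursion, so that the weights below unfold definitionally
  -- (Data.Nat.Combinatorics._C_ is defined by division).
  _choose_ : ℕ → ℕ → ℕ
  n     choose zero  = 1
  zero  choose suc k = 0
  suc n choose suc k = n choose k + n choose suc k

  n<k⇒n-choose-k≡0 : ∀ {n k} → n < k → n choose k ≡ 0
  n<k⇒n-choose-k≡0 {zero}  {suc k} _         = refl
  n<k⇒n-choose-k≡0 {suc n} {suc k} (s≤s n<k) =
    cong₂ _+_ (n<k⇒n-choose-k≡0 n<k) (n<k⇒n-choose-k≡0 (≤-trans n<k (n≤1+n k)))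

  choose≢0⇒k≤n : ∀ n k → n choose k ≢ 0 → k ≤ n
  choose≢0⇒k≤n n k ≢0 with k ≤? n
  ... | yes k≤n = k≤n
  ... | no  k≰n = ⊥-elim (≢0 (n<k⇒n-choose-k≡0 (≰⇒> k≰n)))

  n-choose-n≡1 : ∀ n → n choose n ≡ 1
  n-choose-n≡1 zero    = refl
  n-choose-n≡1 (suc n) = cong₂ _+_ (n-choose-n≡1 n) (n<k⇒n-choose-k≡0 (n<1+n n))

  choose-*-!-! : ∀ a b → (a + b) choose a * (a ! * b !) ≡ (a + b) !
  choose-*-!-! zero    b       = trans (*-identityˡ _) (*-identityˡ _)
  choose-*-!-! (suc a) zero    rewrite +-identityʳ a =
    trans (cong (_* (suc a ! * 1)) (n-choose-n≡1 (suc a))) (trans (*-identityˡ _) (*-identityʳ _))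
  choose-*-!-! (suc a) (suc b) = begin
    ((a + suc b) choose a + (a + suc b) choose suc a) * (suc a ! * suc b !)
      ≡⟨ *-distribʳ-+ (suc a ! * suc b !) ((a + suc b) choose a) _ ⟩
    (a + suc b) choose a * (suc a ! * suc b !) + (a + suc b) choose suc a * (suc a ! * suc b !)
      ≡⟨ cong₂ _+_ (pull-suc-a ((a + suc b) choose a) (suc a) (a !) (suc b !))
                   (trans (cong (λ t → t choose suc a * (suc a ! * suc b !)) (+-suc a b))
                          (pull-suc-b ((suc a + b) choose suc a) (suc a !) (suc b) (b !))) ⟩
    suc a * ((a + suc b) choose a * (a ! * suc b !)) + suc b * ((suc a + b) choose suc a * (suc a ! * b !))
      ≡⟨ cong₂ (λ x y → suc a * x + suc b * y) (choose-*-!-! a (suc b)) (choose-*-!-! (suc a) b) ⟩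
    suc a * (a + suc b) ! + suc b * (suc a + b) !
      ≡⟨ cong (λ t → suc a * (a + suc b) ! + suc b * t !) (sym (+-suc a b)) ⟩
    suc a * (a + suc b) ! + suc b * (a + suc b) !
      ≡⟨ sym (*-distribʳ-+ ((a + suc b) !) (suc a) (suc b)) ⟩
    (suc a + suc b) !  ∎
    where
    pull-suc-a : ∀ x s fa fb → x * (s * fa * fb) ≡ s * (x * (fa * fb))
    pull-suc-a = solve-∀
    pull-suc-b : ∀ x fa s fb → x * (fa * (s * fb)) ≡ s * (x * (fa * fb))
    pull-suc-b = solve-∀

  choose-sym : ∀ a b → (a + b) choose a ≡ (b + a) choose b
  choose-sym a b = *-cancelʳ-≡ _ _ (a ! * b !) {{a !* b !≢0}} (begin
    (a + b) choose a * (a ! * b !)  ≡⟨ choose-*-!-! a b ⟩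
    (a + b) !                       ≡⟨ cong _! (+-comm a b) ⟩
    (b + a) !                       ≡⟨ sym (choose-*-!-! b a) ⟩
    (b + a) choose b * (b ! * a !)  ≡⟨ cong ((b + a) choose b *_) (*-comm (b !) (a !)) ⟩
    (b + a) choose b * (a ! * b !)  ∎)

  choose-nested : ∀ r k p → r choose (k + p) * (k + p) choose k ≡ r choose k * (r ∸ k) choose p
  choose-nested r k p with k + p ≤? r | k ≤? r
  ... | yes k+p≤r | _ = subst (λ r → r choose (k + p) * (k + p) choose k ≡ r choose k * (r ∸ k) choose p)
                              (m+[n∸m]≡n k+p≤r) (trinomial (r ∸ (k + p)))
    where
    trinomial : ∀ c → (k + p + c) choose (k + p) * (k + p) choose k
                    ≡ (k + p + c) choose k * (k + p + c ∸ k) choose p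
    trinomial c = *-cancelʳ-≡ _ _ (k ! * p ! * c !) {{m*n≢0 _ _ {{k !* p !≢0}} {{c !≢0}}}} (begin
      (k + p + c) choose (k + p) * (k + p) choose k * (k ! * p ! * c !)
        ≡⟨ reassocˡ ((k + p + c) choose (k + p)) ((k + p) choose k) (k !) (p !) (c !) ⟩
      (k + p + c) choose (k + p) * ((k + p) choose k * (k ! * p !) * c !)
        ≡⟨ cong (λ t → (k + p + c) choose (k + p) * (t * c !)) (choose-*-!-! k p) ⟩
      (k + p + c) choose (k + p) * ((k + p) ! * c !)
        ≡⟨ choose-*-!-! (k + p) c ⟩
      (k + p + c) !
        ≡⟨ cong _! (+-assoc k p c) ⟩
      (k + (p + c)) !
        ≡⟨ sym (choose-*-!-! k (p + c)) ⟩
      (k + (p + c)) choose k * (k ! * (p + c) !)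
        ≡⟨ cong (λ t → (k + (p + c)) choose k * (k ! * t)) (sym (choose-*-!-! p c)) ⟩
      (k + (p + c)) choose k * (k ! * ((p + c) choose p * (p ! * c !)))
        ≡⟨ reassocʳ ((k + (p + c)) choose k) ((p + c) choose p) (k !) (p !) (c !) ⟩
      (k + (p + c)) choose k * (p + c) choose p * (k ! * p ! * c !)
        ≡⟨ cong₂ (λ u v → u choose k * v choose p * (k ! * p ! * c !))
                 (sym (+-assoc k p c)) (sym (trans (cong (_∸ k) (+-assoc k p c)) (m+n∸m≡n k (p + c)))) ⟩
      (k + p + c) choose k * (k + p + c ∸ k) choose p * (k ! * p ! * c !)  ∎)
      where
      reassocˡ : ∀ x y fk fp fc → x * y * (fk * fp * fc) ≡ x * (y * (fk * fp) * fc)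
      reassocˡ = solve-∀
      reassocʳ : ∀ x y fk fp fc → x * (fk * (y * (fp * fc))) ≡ x * y * (fk * fp * fc)
      reassocʳ = solve-∀
  ... | no k+p≰r | yes k≤r = begin
    r choose (k + p) * (k + p) choose k  ≡⟨ cong (_* (k + p) choose k) (n<k⇒n-choose-k≡0 (≰⇒> k+p≰r)) ⟩
    0                                    ≡⟨ sym (*-zeroʳ (r choose k)) ⟩
    r choose k * 0                       ≡⟨ cong (r choose k *_) (sym (n<k⇒n-choose-k≡0 r∸k<p)) ⟩
    r choose k * (r ∸ k) choose p        ∎
    where
    r∸k<p : r ∸ k < p
    r∸k<p = +-cancelˡ-< k (r ∸ k) p (subst (_< k + p) (sym (m+[n∸m]≡n k≤r)) (≰⇒> k+p≰r))
  ... | no k+p≰r | no k≰r = trans (cong (_* (k + p) choose k) (n<k⇒n-choose-k≡0 (≰⇒> k+p≰r)))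
                                 (sym (cong (_* (r ∸ k) choose p) (n<k⇒n-choose-k≡0 (≰⇒> k≰r))))

  choose-disjoint : ∀ r p l → r choose p * (r ∸ p) choose l ≡ r choose l * (r ∸ l) choose p
  choose-disjoint r p l = begin
    r choose p * (r ∸ p) choose l        ≡⟨ sym (choose-nested r p l) ⟩
    r choose (p + l) * (p + l) choose p  ≡⟨ cong₂ (λ u v → r choose u * v) (+-comm p l) (choose-sym p l) ⟩
    r choose (l + p) * (l + p) choose l  ≡⟨ choose-nested r l p ⟩
    r choose l * (r ∸ l) choose p        ∎

  choose-disjoint-* : ∀ r p l (Y : ℕ → ℕ) →
    r choose p * ((r ∸ p) choose l * Y (r ∸ p ∸ l)) ≡ r choose l * ((r ∸ l) choose p * Y (r ∸ l ∸ p))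
  choose-disjoint-* r p l Y = begin
    r choose p * ((r ∸ p) choose l * Y (r ∸ p ∸ l))  ≡⟨ sym (*-assoc (r choose p) _ _) ⟩
    r choose p * (r ∸ p) choose l * Y (r ∸ p ∸ l)    ≡⟨ cong₂ (λ u v → u * Y v) (choose-disjoint r p l) ∸-comm ⟩
    r choose l * (r ∸ l) choose p * Y (r ∸ l ∸ p)    ≡⟨ *-assoc (r choose l) _ _ ⟩
    r choose l * ((r ∸ l) choose p * Y (r ∸ l ∸ p))  ∎
    where
    ∸-comm : r ∸ p ∸ l ≡ r ∸ l ∸ p
    ∸-comm = trans (∸-+-assoc r p l) (trans (cong (r ∸_) (+-comm p l)) (sym (∸-+-assoc r l p)))

  ∑< : ℕ → (ℕ → ℕ) → ℕ
  ∑< zero    f = 0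
  ∑< (suc n) f = f 0 + ∑< n (f ∘ suc)

  ∑<-cong : ∀ n {f g : ℕ → ℕ} → (∀ i → i < n → f i ≡ g i) → ∑< n f ≡ ∑< n g
  ∑<-cong zero    f≡g = refl
  ∑<-cong (suc n) f≡g = cong₂ _+_ (f≡g 0 (s≤s z≤n)) (∑<-cong n (λ i i<n → f≡g (suc i) (s≤s i<n)))

  ∑<-zero : ∀ n {f : ℕ → ℕ} → (∀ i → i < n → f i ≡ 0) → ∑< n f ≡ 0
  ∑<-zero zero    f≡0 = refl
  ∑<-zero (suc n) f≡0 = cong₂ _+_ (f≡0 0 (s≤s z≤n)) (∑<-zero n (λ i i<n → f≡0 (suc i) (s≤s i<n)))

  ∑<-+ : ∀ n (f g : ℕ → ℕ) → ∑< n (λ i → f i + g i) ≡ ∑< n f + ∑< n g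
  ∑<-+ zero    f g = refl
  ∑<-+ (suc n) f g = begin
    (f 0 + g 0) + ∑< n (λ i → f (suc i) + g (suc i))  ≡⟨ cong (f 0 + g 0 +_) (∑<-+ n (f ∘ suc) (g ∘ suc)) ⟩
    (f 0 + g 0) + (∑< n (f ∘ suc) + ∑< n (g ∘ suc))  ≡⟨ +-interchange (f 0) (g 0) _ _ ⟩
    (f 0 + ∑< n (f ∘ suc)) + (g 0 + ∑< n (g ∘ suc))  ∎

  ∑<-*ˡ : ∀ n c (f : ℕ → ℕ) → ∑< n (λ i → c * f i) ≡ c * ∑< n f
  ∑<-*ˡ zero    c f = sym (*-zeroʳ c)
  ∑<-*ˡ (suc n) c f = trans (cong (c * f 0 +_) (∑<-*ˡ n c (f ∘ suc))) (sym (*-distribˡ-+ c (f 0) _))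

  ∑<-split : ∀ n m (f : ℕ → ℕ) → ∑< (n + m) f ≡ ∑< n f + ∑< m (λ i → f (n + i))
  ∑<-split zero    m f = refl
  ∑<-split (suc n) m f = trans (cong (f 0 +_) (∑<-split n m (f ∘ suc))) (sym (+-assoc (f 0) _ _))

  ∑<-last : ∀ n (f : ℕ → ℕ) → ∑< (suc n) f ≡ ∑< n f + f n
  ∑<-last n f = begin
    ∑< (suc n) f                  ≡⟨ cong (λ t → ∑< t f) (+-comm 1 n) ⟩
    ∑< (n + 1) f                  ≡⟨ ∑<-split n 1 f ⟩
    ∑< n f + (f (n + 0) + 0)      ≡⟨ cong (λ t → ∑< n f + (f t + 0)) (+-identityʳ n) ⟩
    ∑< n f + (f n + 0)            ≡⟨ cong (∑< n f +_) (+-identityʳ (f n)) ⟩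
    ∑< n f + f n                  ∎

  ∑<-vanishing-tail : ∀ n m (f : ℕ → ℕ) → n ≤ m → (∀ i → n ≤ i → f i ≡ 0) → ∑< m f ≡ ∑< n f
  ∑<-vanishing-tail n m f n≤m tail≡0 = begin
    ∑< m f                                       ≡⟨ cong (λ t → ∑< t f) (sym (m+[n∸m]≡n n≤m)) ⟩
    ∑< (n + (m ∸ n)) f                           ≡⟨ ∑<-split n (m ∸ n) f ⟩
    ∑< n f + ∑< (m ∸ n) (λ i → f (n + i))        ≡⟨ cong (∑< n f +_) (∑<-zero (m ∸ n) (λ i _ → tail≡0 (n + i) (m≤m+n n i))) ⟩
    ∑< n f + 0                                   ≡⟨ +-identityʳ _ ⟩
    ∑< n f                                       ∎

  ∑-choose-pascal : ∀ r (X : ℕ → ℕ) →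
    ∑< (suc (suc r)) (λ p → suc r choose p * X p) ≡ ∑< (suc r) (λ p → r choose p * (X p + X (suc p)))
  ∑-choose-pascal r X = begin
    1 * X 0 + ∑< (suc r) (λ i → (r choose i + r choose suc i) * X (suc i))
      ≡⟨ cong₂ _+_ (*-identityˡ (X 0))
                   (trans (∑<-cong (suc r) (λ i _ → *-distribʳ-+ (X (suc i)) (r choose i) (r choose suc i)))
                          (∑<-+ (suc r) (λ i → r choose i * X (suc i)) (λ i → r choose suc i * X (suc i)))) ⟩
    X 0 + (shifted + ∑< (suc r) (λ i → r choose suc i * X (suc i)))
      ≡⟨ cong (λ t → X 0 + (shifted + t)) (∑<-last r (λ i → r choose suc i * X (suc i))) ⟩
    X 0 + (shifted + (∑< r (λ i → r choose suc i * X (suc i)) + r choose suc r * X (suc r)))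
      ≡⟨ cong (λ t → X 0 + (shifted + (∑< r (λ i → r choose suc i * X (suc i)) + t * X (suc r))))
              (n<k⇒n-choose-k≡0 (n<1+n r)) ⟩
    X 0 + (shifted + (∑< r (λ i → r choose suc i * X (suc i)) + 0))
      ≡⟨ rearrange (X 0) shifted (∑< r (λ i → r choose suc i * X (suc i))) ⟩
    (1 * X 0 + ∑< r (λ i → r choose suc i * X (suc i))) + shifted
      ≡⟨ sym (∑<-+ (suc r) (λ p → r choose p * X p) (λ p → r choose p * X (suc p))) ⟩
    ∑< (suc r) (λ p → r choose p * X p + r choose p * X (suc p))
      ≡⟨ ∑<-cong (suc r) (λ p _ → sym (*-distribˡ-+ (r choose p) (X p) (X (suc p)))) ⟩
    ∑< (suc r) (λ p → r choose p * (X p + X (suc p)))  ∎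
    where
    shifted = ∑< (suc r) (λ i → r choose i * X (suc i))
    rearrange : ∀ a b c → a + (b + (c + 0)) ≡ (1 * a + c) + b
    rearrange = solve-∀

  ∑-choose-nested : ∀ r k (Y : ℕ → ℕ → ℕ) →
    ∑< (suc r) (λ p → r choose p * (p choose k * Y (p ∸ k) (r ∸ p))) ≡
    r choose k * ∑< (suc (r ∸ k)) (λ p → (r ∸ k) choose p * Y p (r ∸ k ∸ p))
  ∑-choose-nested r k Y with k ≤? r
  ... | no k≰r = begin
    ∑< (suc r) f
      ≡⟨ ∑<-zero (suc r) (λ i i<1+r → trans (cong (λ t → r choose i * (t * Y (i ∸ k) (r ∸ i))) (n<k⇒n-choose-k≡0 (≤-<-trans (s≤s⁻¹ i<1+r) (≰⇒> k≰r))))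
                                            (*-zeroʳ (r choose i))) ⟩
    0
      ≡⟨ sym (cong (_* ∑< (suc (r ∸ k)) (λ p → (r ∸ k) choose p * Y p (r ∸ k ∸ p))) (n<k⇒n-choose-k≡0 (≰⇒> k≰r))) ⟩
    r choose k * ∑< (suc (r ∸ k)) (λ p → (r ∸ k) choose p * Y p (r ∸ k ∸ p))  ∎
    where
    f = λ p → r choose p * (p choose k * Y (p ∸ k) (r ∸ p))
  ... | yes k≤r = begin
    ∑< (suc r) f                                      ≡⟨ cong (λ t → ∑< t f) (sym k+[1+t]≡1+r) ⟩
    ∑< (k + suc t) f                                  ≡⟨ ∑<-split k (suc t) f ⟩
    ∑< k f + ∑< (suc t) (λ p → f (k + p))
      ≡⟨ cong₂ _+_ (∑<-zero k (λ i i<k → trans (cong (λ z → r choose i * (z * Y (i ∸ k) (r ∸ i))) (n<k⇒n-choose-k≡0 i<k)) (*-zeroʳ (r choose i))))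
                   (∑<-cong (suc t) (λ p _ → shift p)) ⟩
    0 + ∑< (suc t) (λ p → r choose k * (t choose p * Y p (t ∸ p)))
      ≡⟨ ∑<-*ˡ (suc t) (r choose k) (λ p → t choose p * Y p (t ∸ p)) ⟩
    r choose k * ∑< (suc t) (λ p → t choose p * Y p (t ∸ p))  ∎
    where
    t = r ∸ k
    f = λ p → r choose p * (p choose k * Y (p ∸ k) (r ∸ p))
    k+[1+t]≡1+r : k + suc t ≡ suc r
    k+[1+t]≡1+r = trans (+-suc k t) (cong suc (m+[n∸m]≡n k≤r))
    shift : ∀ p → f (k + p) ≡ r choose k * (t choose p * Y p (t ∸ p))
    shift p = begin
      r choose (k + p) * ((k + p) choose k * Y (k + p ∸ k) (r ∸ (k + p)))
        ≡⟨ cong₂ (λ u v → r choose (k + p) * ((k + p) choose k * Y u v)) (m+n∸m≡n k p) (sym (∸-+-assoc r k p)) ⟩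
      r choose (k + p) * ((k + p) choose k * Y p (t ∸ p))
        ≡⟨ sym (*-assoc (r choose (k + p)) _ _) ⟩
      r choose (k + p) * (k + p) choose k * Y p (t ∸ p)
        ≡⟨ cong (_* Y p (t ∸ p)) (choose-nested r k p) ⟩
      r choose k * t choose p * Y p (t ∸ p)
        ≡⟨ *-assoc (r choose k) _ _ ⟩
      r choose k * (t choose p * Y p (t ∸ p))  ∎

  ∑-choose-disjoint : ∀ r l (Y : ℕ → ℕ → ℕ) →
    ∑< (suc r) (λ p → r choose p * ((r ∸ p) choose l * Y p (r ∸ p ∸ l))) ≡
    r choose l * ∑< (suc (r ∸ l)) (λ p → (r ∸ l) choose p * Y p (r ∸ l ∸ p))
  ∑-choose-disjoint r l Y = begin
    ∑< (suc r) (λ p → r choose p * ((r ∸ p) choose l * Y p (r ∸ p ∸ l)))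
      ≡⟨ ∑<-cong (suc r) (λ p _ → choose-disjoint-* r p l (Y p)) ⟩
    ∑< (suc r) (λ p → r choose l * ((r ∸ l) choose p * Y p (r ∸ l ∸ p)))
      ≡⟨ ∑<-*ˡ (suc r) (r choose l) g ⟩
    r choose l * ∑< (suc r) (λ p → (r ∸ l) choose p * Y p (r ∸ l ∸ p))
      ≡⟨ cong (r choose l *_) (∑<-vanishing-tail (suc (r ∸ l)) (suc r) g (s≤s (m∸n≤m r l))
                                (λ i 1+r∸l≤i → cong (_* Y i (r ∸ l ∸ i)) (n<k⇒n-choose-k≡0 1+r∸l≤i))) ⟩
    r choose l * ∑< (suc (r ∸ l)) (λ p → (r ∸ l) choose p * Y p (r ∸ l ∸ p))  ∎
    where
    g = λ p → (r ∸ l) choose p * Y p (r ∸ l ∸ p)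

  IsCompositionOf : ℕ → Composition → Set
  IsCompositionOf n K = IsComposition K × size K ≡ n

  -- Defs keeps the generating step of compositions private; unification recovers it.
  compositions-step : Σ (Composition → List Composition) λ step →
                      ∀ n → compositions (suc n) ≡ concatMap step (compositions n)
  compositions-step = _ , λ _ → refl

  private
    step : Composition → List Composition
    step = proj₁ compositions-step

  compositions-sound : ∀ n → All (IsCompositionOf n) (compositions n)
  compositions-sound zero    = ([] , refl) ∷ []
  compositions-sound (suc n) = Allₚ.concat⁺ (Allₚ.map⁺ (All.map step-sound (compositions-sound n)))
    where
    step-sound : ∀ {K} → IsCompositionOf n K → All (IsCompositionOf (suc n)) (step K)
    step-sound {[]}    (_ , |K|≡n)             = (s≤s z≤n ∷ [] , cong suc |K|≡n) ∷ []
    step-sound {k ∷ K} (0<k ∷ isK , |K|≡n) =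
      (s≤s z≤n ∷ 0<k ∷ isK , cong suc |K|≡n) ∷ (s≤s z≤n ∷ isK , cong suc |K|≡n) ∷ []

  compositions-IsComposition : ∀ n → All IsComposition (compositions n)
  compositions-IsComposition n = All.map proj₁ (compositions-sound n)

  private
    unstep : Composition → Composition
    unstep []                = []
    unstep (zero ∷ K)        = K
    unstep (suc zero ∷ K)    = K
    unstep (suc (suc k) ∷ K) = suc k ∷ K

    unstep-sound : ∀ {n K} → IsComposition K → size K ≡ suc n → IsCompositionOf n (unstep K)
    unstep-sound {K = suc zero ∷ K}    (_ ∷ isK) |K|≡1+n = isK , suc-injective |K|≡1+n
    unstep-sound {K = suc (suc k) ∷ K} (_ ∷ isK) |K|≡1+n = s≤s z≤n ∷ isK , suc-injective |K|≡1+n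

    _≟ᶜ_ : DecidableEquality Composition
    _≟ᶜ_ = ≡-dec _≟_

    count-step : ∀ K K′ → IsComposition K → IsComposition K′ → K ≢ [] →
                 count _≟ᶜ_ K (step K′) ≡ ⟦ unstep K ≟ᶜ K′ ⟧
    count-step []                K′      _          _            K≢[] = ⊥-elim (K≢[] refl)
    count-step (zero ∷ K)        K′      (() ∷ _)   _            _
    count-step (suc zero ∷ K)    []      _          _            _    =
      trans (+-identityʳ _) (⟦⟧-⇔ ((1 ∷ K) ≟ᶜ (1 ∷ [])) (K ≟ᶜ []) (proj₂ ∘ ∷-injective) (cong (1 ∷_)))
    count-step (suc zero ∷ K)    (j ∷ J) _          (0<j ∷ _)    _    = begin
      ⟦ (1 ∷ K) ≟ᶜ (1 ∷ j ∷ J) ⟧ + (⟦ (1 ∷ K) ≟ᶜ (suc j ∷ J) ⟧ + 0)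
        ≡⟨ cong₂ _+_ (⟦⟧-⇔ ((1 ∷ K) ≟ᶜ (1 ∷ j ∷ J)) (K ≟ᶜ (j ∷ J)) (proj₂ ∘ ∷-injective) (cong (1 ∷_)))
                     (cong (_+ 0) (⟦⟧-no ((1 ∷ K) ≟ᶜ (suc j ∷ J)) (λ e → <⇒≢ 0<j (suc-injective (proj₁ (∷-injective e)))))) ⟩
      ⟦ K ≟ᶜ (j ∷ J) ⟧ + 0  ≡⟨ +-identityʳ _ ⟩
      ⟦ K ≟ᶜ (j ∷ J) ⟧      ∎
    count-step (suc (suc k) ∷ K) []      _          _            _    =
      trans (cong (_+ 0) (⟦⟧-no ((suc (suc k) ∷ K) ≟ᶜ (1 ∷ [])) (1+n≢0 ∘ suc-injective ∘ proj₁ ∘ ∷-injective)))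
            (⟦⟧-no ((suc k ∷ K) ≟ᶜ []) λ ())
    count-step (suc (suc k) ∷ K) (j ∷ J) _          _            _    =
      trans (cong₂ _+_ (⟦⟧-no ((suc (suc k) ∷ K) ≟ᶜ (1 ∷ j ∷ J)) (1+n≢0 ∘ suc-injective ∘ proj₁ ∘ ∷-injective))
                       (cong (_+ 0) (⟦⟧-⇔ ((suc (suc k) ∷ K) ≟ᶜ (suc j ∷ J)) ((suc k ∷ K) ≟ᶜ (j ∷ J))
                                           (λ e → cong₂ _∷_ (suc-injective (proj₁ (∷-injective e))) (proj₂ (∷-injective e)))
                                           (λ e → cong₂ _∷_ (cong suc (proj₁ (∷-injective e))) (proj₂ (∷-injective e))))))
            (+-identityʳ _)

  count-compositions : ∀ n K → IsCompositionOf n K → count (≡-dec _≟_) K (compositions n) ≡ 1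
  count-compositions zero    []      _                 = refl
  count-compositions zero    (k ∷ K) (0<k ∷ _ , |K|≡0) = ⊥-elim (<⇒≢ (<-≤-trans 0<k (m≤m+n k (size K))) (sym |K|≡0))
  count-compositions (suc n) K       (isK , |K|≡1+n)   = begin
    count _≟ᶜ_ K (concatMap step (compositions n))
      ≡⟨ ∑-concatMap step (compositions n) _ ⟩
    ∑ (compositions n) (λ K′ → count _≟ᶜ_ K (step K′))
      ≡⟨ ∑-congᴬ (compositions n) (All.map (λ {K′} isK′ → count-step K K′ isK (proj₁ isK′) K≢[]) (compositions-sound n)) ⟩
    count _≟ᶜ_ (unstep K) (compositions n)
      ≡⟨ count-compositions n (unstep K) (unstep-sound isK |K|≡1+n) ⟩
    1  ∎
    where
    K≢[] : K ≢ []
    K≢[] refl = 1+n≢0 (sym |K|≡1+n)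

  private
    a^k-b-injective : ∀ k k′ (x y : List Bool) →
                      replicate k false ++ true ∷ x ≡ replicate k′ false ++ true ∷ y → k ≡ k′ × x ≡ y
    a^k-b-injective zero    zero     x y e = refl , proj₂ (∷-injective e)
    a^k-b-injective (suc k) (suc k′) x y e with a^k-b-injective k k′ x y (proj₂ (∷-injective e))
    ... | refl , x≡y = refl , x≡y

  W-injective : ∀ P Q → IsComposition P → IsComposition Q → W P ≡ W Q → P ≡ Q
  W-injective []          []          _          _          _ = refl
  W-injective []          (suc q ∷ Q) _          _          e with replicate q false | e
  ... | []    | ()
  ... | _ ∷ _ | ()
  W-injective (suc p ∷ P) []          _          _          e with replicate p false | e
  ... | []    | ()
  ... | _ ∷ _ | ()
  W-injective (suc p ∷ P) (suc q ∷ Q) (_ ∷ isP) (_ ∷ isQ) e with a^k-b-injective p q (W P) (W Q) e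
  ... | refl , WP≡WQ = cong (suc p ∷_) (W-injective P Q isP isQ WP≡WQ)

  length-W : ∀ P → IsComposition P → length (W P) ≡ size P
  length-W []          _         = refl
  length-W (suc p ∷ P) (_ ∷ isP) = begin
    length (replicate p false ++ true ∷ W P)  ≡⟨ length-++ (replicate p false) ⟩
    length (replicate p false) + suc (length (W P))
      ≡⟨ cong₂ _+_ (length-replicate p) (cong suc (length-W P isP)) ⟩
    p + suc (size P)                          ≡⟨ +-suc p (size P) ⟩
    suc p + size P                            ∎

  count-map-W : ∀ P X → IsComposition P → All IsComposition X →
                count (≡-dec _≟B_) (W P) (map W X) ≡ count (≡-dec _≟_) P X
  count-map-W P []      _   []          = refl
  count-map-W P (Q ∷ X) isP (isQ ∷ isX) =
    cong₂ _+_ (⟦⟧-⇔ (≡-dec _≟B_ (W P) (W Q)) (≡-dec _≟_ P Q) (W-injective P Q isP isQ) (cong W))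
              (count-map-W P X isP isX)

  All-shuffle : {A : Set} (Q : A → Set) {xs ys : List A} → All Q xs → All Q ys → All (All Q) (shuffle xs ys)
  All-shuffle Q {[]}     {ys}     _             Qys           = Qys ∷ []
  All-shuffle Q {x ∷ xs} {[]}     Qxs           _             = Qxs ∷ []
  All-shuffle Q {x ∷ xs} {y ∷ ys} (Qx ∷ Qxs)   (Qy ∷ Qys)   =
    Allₚ.++⁺ (Allₚ.map⁺ (All.map (Qx ∷_) (All-shuffle Q Qxs (Qy ∷ Qys))))
             (Allₚ.map⁺ (All.map (Qy ∷_) (All-shuffle Q (Qx ∷ Qxs) Qys)))

  size-shuffle : (xs ys : List ℕ) → All (λ K → size K ≡ size xs + size ys) (shuffle xs ys)
  size-shuffle []       ys       = refl ∷ []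
  size-shuffle (x ∷ xs) []       = sym (+-identityʳ _) ∷ []
  size-shuffle (x ∷ xs) (y ∷ ys) =
    Allₚ.++⁺ (Allₚ.map⁺ (All.map (λ e → trans (cong (x +_) e) (sym (+-assoc x _ _))) (size-shuffle xs (y ∷ ys))))
             (Allₚ.map⁺ (All.map (λ e → trans (cong (y +_) e) (x+[y+z]≡y+[x+z] y (x + size xs) (size ys))) (size-shuffle (x ∷ xs) ys)))

  shuffle-compositions : ∀ I J → IsComposition I → IsComposition J →
                         All (IsCompositionOf (size I + size J)) (shuffle I J)
  shuffle-compositions I J isI isJ = All.zip (All-shuffle (0 <_) isI isJ , size-shuffle I J)

  deshuffles : {A : Set} → List A → List (List A × List A)
  deshuffles []      = ([] , []) ∷ []
  deshuffles (x ∷ w) = map (λ d → (x ∷ proj₁ d , proj₂ d)) (deshuffles w) ++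
                       map (λ d → (proj₁ d , x ∷ proj₂ d)) (deshuffles w)

  ∑-deshuffles-∷ : {A : Set} (x : A) (w : List A) (F : List A → List A → ℕ) →
    ∑ (deshuffles (x ∷ w)) (λ d → F (proj₁ d) (proj₂ d)) ≡
    ∑ (deshuffles w) (λ d → F (x ∷ proj₁ d) (proj₂ d)) + ∑ (deshuffles w) (λ d → F (proj₁ d) (x ∷ proj₂ d))
  ∑-deshuffles-∷ x w F = trans (∑-++ (map _ (deshuffles w)) _ _) (cong₂ _+_ (∑-map _ (deshuffles w) _) (∑-map _ (deshuffles w) _))

  module _ {A : Set} (_≟ᴬ_ : DecidableEquality A) where

    private
      _≟*_ : DecidableEquality (List A)
      _≟*_ = ≡-dec _≟ᴬ_

    ∑-deshuffles-[]ˡ : ∀ w (G : List A → ℕ) → ∑ (deshuffles w) (λ d → ⟦ [] ≟* proj₁ d ⟧ * G (proj₂ d)) ≡ G w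
    ∑-deshuffles-[]ˡ []      G = trans (+-identityʳ _) (+-identityʳ _)
    ∑-deshuffles-[]ˡ (x ∷ w) G = trans (∑-deshuffles-∷ x w (λ u v → ⟦ [] ≟* u ⟧ * G v))
      (cong₂ _+_ (∑-zero (deshuffles w) (λ _ → refl)) (∑-deshuffles-[]ˡ w (G ∘ (x ∷_))))

    ∑-deshuffles-[]ʳ : ∀ w (G : List A → ℕ) → ∑ (deshuffles w) (λ d → G (proj₁ d) * ⟦ [] ≟* proj₂ d ⟧) ≡ G w
    ∑-deshuffles-[]ʳ []      G = trans (+-identityʳ _) (*-identityʳ _)
    ∑-deshuffles-[]ʳ (x ∷ w) G = trans (∑-deshuffles-∷ x w (λ u v → G u * ⟦ [] ≟* v ⟧))
      (trans (cong₂ _+_ (∑-deshuffles-[]ʳ w (G ∘ (x ∷_))) (∑-zero (deshuffles w) (λ d → *-zeroʳ (G (proj₁ d)))))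
             (+-identityʳ _))

    count-∷-map : ∀ z w x ws → count _≟*_ (z ∷ w) (map (x ∷_) ws) ≡ ⟦ z ≟ᴬ x ⟧ * count _≟*_ w ws
    count-∷-map z w x ws = trans (∑-map (x ∷_) ws _) (trans (∑-cong ws (⟦⟧-∷ _≟ᴬ_ z x w)) (∑-*ˡ ws ⟦ z ≟ᴬ x ⟧ _))

    count-shuffle : ∀ w u v →
      count _≟*_ w (shuffle u v) ≡ ∑ (deshuffles w) (λ d → ⟦ u ≟* proj₁ d ⟧ * ⟦ v ≟* proj₂ d ⟧)
    count-shuffle w       []      v       =
      trans (+-identityʳ _) (trans (⟦⟧-sym _≟*_ w v) (sym (∑-deshuffles-[]ˡ w (λ d → ⟦ v ≟* d ⟧))))
    count-shuffle w       (x ∷ u) []      =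
      trans (+-identityʳ _) (trans (⟦⟧-sym _≟*_ w (x ∷ u)) (sym (∑-deshuffles-[]ʳ w (λ d → ⟦ (x ∷ u) ≟* d ⟧))))
    count-shuffle []      (x ∷ u) (y ∷ v) = begin
      count _≟*_ [] (map (x ∷_) (shuffle u (y ∷ v)) ++ map (y ∷_) (shuffle (x ∷ u) v))
        ≡⟨ ∑-++ (map (x ∷_) (shuffle u (y ∷ v))) _ _ ⟩
      count _≟*_ [] (map (x ∷_) (shuffle u (y ∷ v))) + count _≟*_ [] (map (y ∷_) (shuffle (x ∷ u) v))
        ≡⟨ cong₂ _+_ (trans (∑-map (x ∷_) (shuffle u (y ∷ v)) _) (∑-zero (shuffle u (y ∷ v)) (λ _ → refl)))
                     (trans (∑-map (y ∷_) (shuffle (x ∷ u) v) _) (∑-zero (shuffle (x ∷ u) v) (λ _ → refl))) ⟩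
      0  ∎
    count-shuffle (z ∷ w) (x ∷ u) (y ∷ v) = begin
      count _≟*_ (z ∷ w) (map (x ∷_) (shuffle u (y ∷ v)) ++ map (y ∷_) (shuffle (x ∷ u) v))
        ≡⟨ ∑-++ (map (x ∷_) (shuffle u (y ∷ v))) _ _ ⟩
      count _≟*_ (z ∷ w) (map (x ∷_) (shuffle u (y ∷ v))) + count _≟*_ (z ∷ w) (map (y ∷_) (shuffle (x ∷ u) v))
        ≡⟨ cong₂ _+_ (count-∷-map z w x (shuffle u (y ∷ v))) (count-∷-map z w y (shuffle (x ∷ u) v)) ⟩
      ⟦ z ≟ᴬ x ⟧ * count _≟*_ w (shuffle u (y ∷ v)) + ⟦ z ≟ᴬ y ⟧ * count _≟*_ w (shuffle (x ∷ u) v)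
        ≡⟨ cong₂ (λ a b → ⟦ z ≟ᴬ x ⟧ * a + ⟦ z ≟ᴬ y ⟧ * b) (count-shuffle w u (y ∷ v)) (count-shuffle w (x ∷ u) v) ⟩
      ⟦ z ≟ᴬ x ⟧ * ∑ (deshuffles w) (λ d → ⟦ u ≟* proj₁ d ⟧ * ⟦ (y ∷ v) ≟* proj₂ d ⟧) +
      ⟦ z ≟ᴬ y ⟧ * ∑ (deshuffles w) (λ d → ⟦ (x ∷ u) ≟* proj₁ d ⟧ * ⟦ v ≟* proj₂ d ⟧)
        ≡⟨ sym (cong₂ _+_ (trans (∑-cong (deshuffles w) left) (∑-*ˡ (deshuffles w) ⟦ z ≟ᴬ x ⟧ _))
                          (trans (∑-cong (deshuffles w) right) (∑-*ˡ (deshuffles w) ⟦ z ≟ᴬ y ⟧ _))) ⟩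
      ∑ (deshuffles w) (λ d → ⟦ (x ∷ u) ≟* (z ∷ proj₁ d) ⟧ * ⟦ (y ∷ v) ≟* proj₂ d ⟧) +
      ∑ (deshuffles w) (λ d → ⟦ (x ∷ u) ≟* proj₁ d ⟧ * ⟦ (y ∷ v) ≟* (z ∷ proj₂ d) ⟧)
        ≡⟨ sym (∑-deshuffles-∷ z w (λ a b → ⟦ (x ∷ u) ≟* a ⟧ * ⟦ (y ∷ v) ≟* b ⟧)) ⟩
      ∑ (deshuffles (z ∷ w)) (λ d → ⟦ (x ∷ u) ≟* proj₁ d ⟧ * ⟦ (y ∷ v) ≟* proj₂ d ⟧)  ∎
      where
      left : ∀ d → ⟦ (x ∷ u) ≟* (z ∷ proj₁ d) ⟧ * ⟦ (y ∷ v) ≟* proj₂ d ⟧ ≡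
                   ⟦ z ≟ᴬ x ⟧ * (⟦ u ≟* proj₁ d ⟧ * ⟦ (y ∷ v) ≟* proj₂ d ⟧)
      left d = trans (cong (_* ⟦ (y ∷ v) ≟* proj₂ d ⟧)
                           (trans (⟦⟧-∷ _≟ᴬ_ x z u (proj₁ d)) (cong (_* ⟦ u ≟* proj₁ d ⟧) (⟦⟧-sym _≟ᴬ_ x z))))
                     (*-assoc ⟦ z ≟ᴬ x ⟧ _ _)
      right : ∀ d → ⟦ (x ∷ u) ≟* proj₁ d ⟧ * ⟦ (y ∷ v) ≟* (z ∷ proj₂ d) ⟧ ≡
                    ⟦ z ≟ᴬ y ⟧ * (⟦ (x ∷ u) ≟* proj₁ d ⟧ * ⟦ v ≟* proj₂ d ⟧)
      right d = trans (cong (⟦ (x ∷ u) ≟* proj₁ d ⟧ *_)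
                            (trans (⟦⟧-∷ _≟ᴬ_ y z v (proj₂ d)) (cong (_* ⟦ v ≟* proj₂ d ⟧) (⟦⟧-sym _≟ᴬ_ y z))))
                      (x*[y*z]≡y*[x*z] ⟦ (x ∷ u) ≟* proj₁ d ⟧ ⟦ z ≟ᴬ y ⟧ _)

  -- Read w ∈ {a,b}* as the elements 1, 2, … of a set partition: a (false) is an
  -- element whose block is still open, b (true) closes a block of the next size ℓ
  -- of I, whose other ℓ - 1 elements are chosen among the s elements still open.
  accept : ℕ → Composition → ℕ
  accept _       (_ ∷ _) = 0
  accept zero    []      = 1
  accept (suc _) []      = 0

  ways : ℕ → Composition → List Bool → ℕ
  ways s I       []          = accept s I
  ways s I       (false ∷ w) = ways (suc s) I w
  ways s []      (true ∷ w)  = 0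
  ways s (ℓ ∷ I) (true ∷ w)  = s choose pred ℓ * ways (s ∸ pred ℓ) I w

  ways-a^k : ∀ k s I w → ways s I (replicate k false ++ w) ≡ ways (k + s) I w
  ways-a^k zero    s I w = refl
  ways-a^k (suc k) s I w = trans (ways-a^k k (suc s) I w) (cong (λ t → ways t I w) (+-suc k s))

  ways₂ : ℕ → ℕ → Composition → Composition → List Bool → ℕ
  ways₂ p q I J w = ∑ (deshuffles w) (λ d → ways p I (proj₁ d) * ways q J (proj₂ d))

  ways₂-[]ˡ : ∀ w p (g : List Bool → ℕ) →
              ∑ (deshuffles w) (λ d → ways p [] (proj₁ d) * g (proj₂ d)) ≡ accept p [] * g w
  ways₂-[]ˡ []          p g = +-identityʳ _
  ways₂-[]ˡ (false ∷ w) p g = trans (∑-deshuffles-∷ false w (λ u v → ways p [] u * g v))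
    (cong₂ _+_ (ways₂-[]ˡ w (suc p) g) (ways₂-[]ˡ w p (g ∘ (false ∷_))))
  ways₂-[]ˡ (true ∷ w)  p g = trans (∑-deshuffles-∷ true w (λ u v → ways p [] u * g v))
    (cong₂ _+_ (∑-zero (deshuffles w) (λ _ → refl)) (ways₂-[]ˡ w p (g ∘ (true ∷_))))

  ways₂-[]ʳ : ∀ w q (g : List Bool → ℕ) →
              ∑ (deshuffles w) (λ d → g (proj₁ d) * ways q [] (proj₂ d)) ≡ g w * accept q []
  ways₂-[]ʳ []          q g = +-identityʳ _
  ways₂-[]ʳ (false ∷ w) q g = trans (∑-deshuffles-∷ false w (λ u v → g u * ways q [] v))
    (trans (cong₂ _+_ (ways₂-[]ʳ w q (g ∘ (false ∷_))) (ways₂-[]ʳ w (suc q) g))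
           (trans (cong (g (false ∷ w) * accept q [] +_) (*-zeroʳ (g w))) (+-identityʳ _)))
  ways₂-[]ʳ (true ∷ w)  q g = trans (∑-deshuffles-∷ true w (λ u v → g u * ways q [] v))
    (trans (cong₂ _+_ (ways₂-[]ʳ w q (g ∘ (true ∷_))) (∑-zero (deshuffles w) (λ d → *-zeroʳ (g (proj₁ d)))))
           (+-identityʳ _))

  ways₂-a : ∀ p q I J w → ways₂ p q I J (false ∷ w) ≡ ways₂ (suc p) q I J w + ways₂ p (suc q) I J w
  ways₂-a p q I J w = ∑-deshuffles-∷ false w (λ u v → ways p I u * ways q J v)

  ways₂-b : ∀ p q i I j J w → ways₂ p q (i ∷ I) (j ∷ J) (true ∷ w) ≡
            p choose pred i * ways₂ (p ∸ pred i) q I (j ∷ J) w + q choose pred j * ways₂ p (q ∸ pred j) (i ∷ I) J w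
  ways₂-b p q i I j J w = trans (∑-deshuffles-∷ true w (λ u v → ways p (i ∷ I) u * ways q (j ∷ J) v))
    (cong₂ _+_
      (trans (∑-cong (deshuffles w) (λ d → *-assoc (p choose pred i) _ _)) (∑-*ˡ (deshuffles w) (p choose pred i) _))
      (trans (∑-cong (deshuffles w) (λ d → x*[y*z]≡y*[x*z] (ways p (i ∷ I) (proj₁ d)) (q choose pred j) _))
             (∑-*ˡ (deshuffles w) (q choose pred j) _)))

  -- The r open elements are shared between the two shuffled factors: p of them go to I.
  ways-shuffle : ∀ w r I J →
    ∑ (shuffle I J) (λ K → ways r K w) ≡ ∑< (suc r) (λ p → r choose p * ways₂ p (r ∸ p) I J w)
  ways-shuffle w r [] J = begin
    ways r J w + 0                             ≡⟨ +-identityʳ _ ⟩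
    ways r J w                                 ≡⟨ sym (trans (*-identityˡ _) (trans (ways₂-[]ˡ w 0 (ways r J)) (*-identityˡ _))) ⟩
    1 * ways₂ 0 r [] J w                       ≡⟨ sym (+-identityʳ _) ⟩
    1 * ways₂ 0 r [] J w + 0                   ≡⟨ cong (1 * ways₂ 0 r [] J w +_) (sym (∑<-zero r (λ p _ → others p))) ⟩
    ∑< (suc r) (λ p → r choose p * ways₂ p (r ∸ p) [] J w)  ∎
    where
    others : ∀ p → r choose suc p * ways₂ (suc p) (r ∸ suc p) [] J w ≡ 0
    others p = trans (cong (r choose suc p *_) (ways₂-[]ˡ w (suc p) (ways (r ∸ suc p) J))) (*-zeroʳ (r choose suc p))
  ways-shuffle w r (i ∷ I) [] = begin
    ways r (i ∷ I) w + 0                           ≡⟨ +-identityʳ _ ⟩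
    ways r (i ∷ I) w                               ≡⟨ sym last ⟩
    r choose r * ways₂ r (r ∸ r) (i ∷ I) [] w      ≡⟨ sym (+-identityˡ _) ⟩
    0 + r choose r * ways₂ r (r ∸ r) (i ∷ I) [] w  ≡⟨ cong (_+ f r) (sym (∑<-zero r others)) ⟩
    ∑< r f + f r                                   ≡⟨ sym (∑<-last r f) ⟩
    ∑< (suc r) f  ∎
    where
    f = λ p → r choose p * ways₂ p (r ∸ p) (i ∷ I) [] w
    others : ∀ p → p < r → f p ≡ 0
    others p p<r = begin
      r choose p * ways₂ p (r ∸ p) (i ∷ I) [] w       ≡⟨ cong (r choose p *_) (ways₂-[]ʳ w (r ∸ p) (ways p (i ∷ I))) ⟩
      r choose p * (ways p (i ∷ I) w * accept (r ∸ p) [])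
        ≡⟨ cong (λ t → r choose p * (ways p (i ∷ I) w * accept t [])) (+-∸-assoc 1 p<r) ⟩
      r choose p * (ways p (i ∷ I) w * 0)             ≡⟨ cong (r choose p *_) (*-zeroʳ (ways p (i ∷ I) w)) ⟩
      r choose p * 0                                  ≡⟨ *-zeroʳ (r choose p) ⟩
      0  ∎
    last : f r ≡ ways r (i ∷ I) w
    last = trans (cong (r choose r *_) (ways₂-[]ʳ w (r ∸ r) (ways r (i ∷ I))))
      (trans (cong₂ (λ u v → u * (ways r (i ∷ I) w * accept v [])) (n-choose-n≡1 r) (n∸n≡0 r))
             (trans (*-identityˡ _) (*-identityʳ _)))
  ways-shuffle [] r (i ∷ I) (j ∷ J) = begin
    ∑ (map (i ∷_) (shuffle I (j ∷ J)) ++ map (j ∷_) (shuffle (i ∷ I) J)) (λ K → ways r K [])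
      ≡⟨ ∑-++ (map (i ∷_) (shuffle I (j ∷ J))) _ (λ K → ways r K []) ⟩
    ∑ (map (i ∷_) (shuffle I (j ∷ J))) (λ K → ways r K []) + ∑ (map (j ∷_) (shuffle (i ∷ I) J)) (λ K → ways r K [])
      ≡⟨ cong₂ _+_ (trans (∑-map (i ∷_) (shuffle I (j ∷ J)) _) (∑-zero (shuffle I (j ∷ J)) (λ _ → refl)))
                   (trans (∑-map (j ∷_) (shuffle (i ∷ I) J) _) (∑-zero (shuffle (i ∷ I) J) (λ _ → refl))) ⟩
    0
      ≡⟨ sym (∑<-zero (suc r) (λ p _ → *-zeroʳ (r choose p))) ⟩
    ∑< (suc r) (λ p → r choose p * ways₂ p (r ∸ p) (i ∷ I) (j ∷ J) [])  ∎
  ways-shuffle (false ∷ w) r (i ∷ I) (j ∷ J) = begin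
    ∑ (shuffle (i ∷ I) (j ∷ J)) (λ K → ways (suc r) K w)
      ≡⟨ ways-shuffle w (suc r) (i ∷ I) (j ∷ J) ⟩
    ∑< (suc (suc r)) (λ p → suc r choose p * X p)
      ≡⟨ ∑-choose-pascal r X ⟩
    ∑< (suc r) (λ p → r choose p * (X p + X (suc p)))
      ≡⟨ ∑<-cong (suc r) (λ p p<1+r → cong (r choose p *_) (regroup p (s≤s⁻¹ p<1+r))) ⟩
    ∑< (suc r) (λ p → r choose p * ways₂ p (r ∸ p) (i ∷ I) (j ∷ J) (false ∷ w))  ∎
    where
    X = λ p → ways₂ p (suc r ∸ p) (i ∷ I) (j ∷ J) w
    regroup : ∀ p → p ≤ r → X p + X (suc p) ≡ ways₂ p (r ∸ p) (i ∷ I) (j ∷ J) (false ∷ w)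
    regroup p p≤r = begin
      X p + X (suc p)                                                                 ≡⟨ +-comm (X p) (X (suc p)) ⟩
      ways₂ (suc p) (r ∸ p) (i ∷ I) (j ∷ J) w + ways₂ p (suc r ∸ p) (i ∷ I) (j ∷ J) w
        ≡⟨ cong (λ t → X (suc p) + ways₂ p t (i ∷ I) (j ∷ J) w) (+-∸-assoc 1 p≤r) ⟩
      ways₂ (suc p) (r ∸ p) (i ∷ I) (j ∷ J) w + ways₂ p (suc (r ∸ p)) (i ∷ I) (j ∷ J) w
        ≡⟨ sym (ways₂-a p (r ∸ p) (i ∷ I) (j ∷ J) w) ⟩
      ways₂ p (r ∸ p) (i ∷ I) (j ∷ J) (false ∷ w)                                     ∎
  ways-shuffle (true ∷ w) r (i ∷ I) (j ∷ J) = begin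
    ∑ (map (i ∷_) (shuffle I (j ∷ J)) ++ map (j ∷_) (shuffle (i ∷ I) J)) (λ K → ways r K (true ∷ w))
      ≡⟨ ∑-++ (map (i ∷_) (shuffle I (j ∷ J))) _ (λ K → ways r K (true ∷ w)) ⟩
    ∑ (map (i ∷_) (shuffle I (j ∷ J))) (λ K → ways r K (true ∷ w)) + ∑ (map (j ∷_) (shuffle (i ∷ I) J)) (λ K → ways r K (true ∷ w))
      ≡⟨ cong₂ _+_ (trans (∑-map (i ∷_) (shuffle I (j ∷ J)) _) (∑-*ˡ (shuffle I (j ∷ J)) (r choose k) _))
                   (trans (∑-map (j ∷_) (shuffle (i ∷ I) J) _) (∑-*ˡ (shuffle (i ∷ I) J) (r choose l) _)) ⟩
    r choose k * ∑ (shuffle I (j ∷ J)) (λ K → ways (r ∸ k) K w) + r choose l * ∑ (shuffle (i ∷ I) J) (λ K → ways (r ∸ l) K w)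
      ≡⟨ cong₂ (λ u v → r choose k * u + r choose l * v) (ways-shuffle w (r ∸ k) I (j ∷ J)) (ways-shuffle w (r ∸ l) (i ∷ I) J) ⟩
    r choose k * ∑< (suc (r ∸ k)) (λ p → (r ∸ k) choose p * ways₂ p (r ∸ k ∸ p) I (j ∷ J) w) +
    r choose l * ∑< (suc (r ∸ l)) (λ p → (r ∸ l) choose p * ways₂ p (r ∸ l ∸ p) (i ∷ I) J w)
      ≡⟨ sym (cong₂ _+_ (∑-choose-nested r k (λ a b → ways₂ a b I (j ∷ J) w))
                        (∑-choose-disjoint r l (λ a b → ways₂ a b (i ∷ I) J w))) ⟩
    ∑< (suc r) closeI + ∑< (suc r) closeJ
      ≡⟨ sym (∑<-+ (suc r) closeI closeJ) ⟩
    ∑< (suc r) (λ p → closeI p + closeJ p)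
      ≡⟨ ∑<-cong (suc r) (λ p _ → trans (sym (*-distribˡ-+ (r choose p) (closeI′ p) (closeJ′ p)))
                                        (cong (r choose p *_) (sym (ways₂-b p (r ∸ p) i I j J w)))) ⟩
    ∑< (suc r) (λ p → r choose p * ways₂ p (r ∸ p) (i ∷ I) (j ∷ J) (true ∷ w))  ∎
    where
    k = pred i
    l = pred j
    closeI′ = λ p → p choose k * ways₂ (p ∸ k) (r ∸ p) I (j ∷ J) w
    closeJ′ = λ p → (r ∸ p) choose l * ways₂ p (r ∸ p ∸ l) (i ∷ I) J w
    closeI = λ p → r choose p * closeI′ p
    closeJ = λ p → r choose p * closeJ′ p

  private
    *-≢0 : ∀ m n → m * n ≢ 0 → m ≢ 0 × n ≢ 0
    *-≢0 m n mn≢0 = (λ m≡0 → mn≢0 (cong (_* n) m≡0)) , (λ n≡0 → mn≢0 (trans (cong (m *_) n≡0) (*-zeroʳ m)))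

  accept≢0 : ∀ s I → accept s I ≢ 0 → s ≡ 0 × I ≡ []
  accept≢0 zero    []      _     = refl , refl
  accept≢0 (suc s) []      ≢0    = ⊥-elim (≢0 refl)
  accept≢0 s       (_ ∷ _) ≢0    = ⊥-elim (≢0 refl)

  ways-close≢0 : ∀ s ℓ I w → ways s (ℓ ∷ I) (true ∷ w) ≢ 0 → pred ℓ ≤ s × ways (s ∸ pred ℓ) I w ≢ 0
  ways-close≢0 s ℓ I w ≢0 with *-≢0 (s choose pred ℓ) _ ≢0
  ... | choose≢0 , rest≢0 = choose≢0⇒k≤n s (pred ℓ) choose≢0 , rest≢0

  ways≢0⇒length : ∀ u s I → IsComposition I → ways s I u ≢ 0 → length u + s ≡ size I
  ways≢0⇒length []          s I           _          ≢0 with accept≢0 s I ≢0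
  ... | refl , refl = refl
  ways≢0⇒length (false ∷ u) s I           isI        ≢0 =
    trans (sym (+-suc (length u) s)) (ways≢0⇒length u (suc s) I isI ≢0)
  ways≢0⇒length (true ∷ u)  s []          _          ≢0 = ⊥-elim (≢0 refl)
  ways≢0⇒length (true ∷ u)  s (suc l ∷ I) (_ ∷ isI) ≢0 with ways-close≢0 s (suc l) I u ≢0
  ... | l≤s , rest≢0 = begin
    suc (length u + s)                ≡⟨ cong (λ t → suc (length u + t)) (sym (m+[n∸m]≡n l≤s)) ⟩
    suc (length u + (l + (s ∸ l)))    ≡⟨ cong suc (x+[y+z]≡y+[x+z] (length u) l (s ∸ l)) ⟩
    suc (l + (length u + (s ∸ l)))    ≡⟨ cong (λ t → suc (l + t)) (ways≢0⇒length u (s ∸ l) I isI rest≢0) ⟩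
    suc l + size I                    ∎

  ways≢0⇒W : ∀ u s k I → ways s I u ≢ 0 → k ≤ s →
             Σ Composition λ P → IsComposition P × W P ≡ replicate k false ++ u
  ways≢0⇒W []          s k       I       ≢0 k≤s with accept≢0 s I ≢0
  ways≢0⇒W []          _ zero    _       _  _   | refl , refl = [] , [] , refl
  ways≢0⇒W (false ∷ u) s k       I       ≢0 k≤s with ways≢0⇒W u (suc s) (suc k) I ≢0 (s≤s k≤s)
  ... | P , isP , WP≡ = P , isP , trans WP≡ (sym (a^k-a k u))
    where
    a^k-a : ∀ k (u : List Bool) → replicate k false ++ false ∷ u ≡ replicate (suc k) false ++ u
    a^k-a zero    u = refl
    a^k-a (suc k) u = cong (false ∷_) (a^k-a k u)
  ways≢0⇒W (true ∷ u)  s k       []      ≢0 k≤s = ⊥-elim (≢0 refl)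
  ways≢0⇒W (true ∷ u)  s k       (ℓ ∷ I) ≢0 k≤s with ways≢0⇒W u (s ∸ pred ℓ) 0 I (proj₂ (ways-close≢0 s ℓ I u ≢0)) z≤n
  ... | P , isP , WP≡u = suc k ∷ P , s≤s z≤n ∷ isP , cong (λ t → replicate k false ++ true ∷ t) WP≡u

  private
    _≟ʷ_ : DecidableEquality (List Bool)
    _≟ʷ_ = ≡-dec _≟B_

  ∑-ways-W : ∀ I u → IsComposition I →
             ∑ (compositions (size I)) (λ P → ⟦ W P ≟ʷ u ⟧ * ways 0 I (W P)) ≡ ways 0 I u
  ∑-ways-W I u isI = begin
    ∑ X (λ P → ⟦ W P ≟ʷ u ⟧ * ways 0 I (W P))  ≡⟨ sym (∑-map W X (λ x → ⟦ x ≟ʷ u ⟧ * ways 0 I x)) ⟩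
    ∑ (map W X) (λ x → ⟦ x ≟ʷ u ⟧ * ways 0 I x) ≡⟨ ∑-cong (map W X) (λ x → ⟦≟⟧-*-subst _≟ʷ_ (ways 0 I) x u) ⟩
    ∑ (map W X) (λ x → ⟦ u ≟ʷ x ⟧ * ways 0 I u) ≡⟨ ∑-*ʳ (map W X) (ways 0 I u) _ ⟩
    count _≟ʷ_ u (map W X) * ways 0 I u        ≡⟨ counted u ⟩
    ways 0 I u                                  ∎
    where
    X = compositions (size I)
    counted : ∀ u → count _≟ʷ_ u (map W X) * ways 0 I u ≡ ways 0 I u
    counted u with ways 0 I u ≟ 0
    ... | yes ≡0 = trans (cong (count _≟ʷ_ u (map W X) *_) ≡0) (trans (*-zeroʳ (count _≟ʷ_ u (map W X))) (sym ≡0))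
    ... | no ≢0 with ways≢0⇒W u 0 0 I ≢0 z≤n
    ... | P , isP , refl = trans (cong (_* ways 0 I (W P)) once) (*-identityˡ _)
      where
      |P|≡|I| : size P ≡ size I
      |P|≡|I| = trans (sym (length-W P isP)) (trans (sym (+-identityʳ _)) (ways≢0⇒length (W P) 0 I isI ≢0))
      once : count _≟ʷ_ (W P) (map W X) ≡ 1
      once = trans (count-map-W P X isP (compositions-IsComposition (size I)))
                   (count-compositions (size I) P (isP , |P|≡|I|))

  ∑-shCoeff-ways : ∀ I J w → IsComposition I → IsComposition J →
    ∑ (compositions (size I + size J)) (λ K → shCoeffComp K I J * ways 0 K w) ≡ ways₂ 0 0 I J w
  ∑-shCoeff-ways I J w isI isJ = begin
    ∑ XK (λ K → shCoeffComp K I J * ways 0 K w)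
      ≡⟨ ∑-cong XK (λ K → cong (_* ways 0 K w) (length-filter≡∑⟦⟧ (≡-dec _≟_ K) (shuffle I J))) ⟩
    ∑ XK (λ K → count (≡-dec _≟_) K (shuffle I J) * ways 0 K w)
      ≡⟨ ∑-count-enumeration (≡-dec _≟_) XK (shuffle I J) (λ K → ways 0 K w)
           (All.map (count-compositions _ _) (shuffle-compositions I J isI isJ)) ⟩
    ∑ (shuffle I J) (λ K → ways 0 K w)
      ≡⟨ ways-shuffle w 0 I J ⟩
    1 * ways₂ 0 0 I J w + 0
      ≡⟨ trans (+-identityʳ _) (*-identityˡ _) ⟩
    ways₂ 0 0 I J w  ∎
    where
    XK = compositions (size I + size J)

  ∑-abCoeff-ways : ∀ I J R → IsComposition I → IsComposition J →
    ∑ (compositions (size I)) (λ P → ∑ (compositions (size J)) (λ Q → ways 0 I (W P) * ways 0 J (W Q) * abCoeff R P Q))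
    ≡ ways₂ 0 0 I J (W R)
  ∑-abCoeff-ways I J R isI isJ = begin
    ∑ XI (λ P → ∑ XJ (λ Q → ways 0 I (W P) * ways 0 J (W Q) * abCoeff R P Q))
      ≡⟨ ∑-cong XI (λ P → ∑-cong XJ (term P)) ⟩
    ∑ XI (λ P → ∑ XJ (λ Q → ∑ (deshuffles w) (λ d → left P d * right Q d)))
      ≡⟨ ∑-cong XI (λ P → ∑-swap XJ (deshuffles w) _) ⟩
    ∑ XI (λ P → ∑ (deshuffles w) (λ d → ∑ XJ (λ Q → left P d * right Q d)))
      ≡⟨ ∑-swap XI (deshuffles w) _ ⟩
    ∑ (deshuffles w) (λ d → ∑ XI (λ P → ∑ XJ (λ Q → left P d * right Q d)))
      ≡⟨ ∑-cong (deshuffles w) (λ d → sym (∑-*-∑ XI XJ (λ P → left P d) (λ Q → right Q d))) ⟩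
    ∑ (deshuffles w) (λ d → ∑ XI (λ P → left P d) * ∑ XJ (λ Q → right Q d))
      ≡⟨ ∑-cong (deshuffles w) (λ d → cong₂ _*_ (∑-ways-W I (proj₁ d) isI) (∑-ways-W J (proj₂ d) isJ)) ⟩
    ways₂ 0 0 I J w  ∎
    where
    XI = compositions (size I)
    XJ = compositions (size J)
    w = W R
    left right : Composition → List Bool × List Bool → ℕ
    left  P d = ⟦ W P ≟ʷ proj₁ d ⟧ * ways 0 I (W P)
    right Q d = ⟦ W Q ≟ʷ proj₂ d ⟧ * ways 0 J (W Q)
    term : ∀ P Q → ways 0 I (W P) * ways 0 J (W Q) * abCoeff R P Q ≡ ∑ (deshuffles w) (λ d → left P d * right Q d)
    term P Q = begin
      ways 0 I (W P) * ways 0 J (W Q) * abCoeff R P Q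
        ≡⟨ cong (ways 0 I (W P) * ways 0 J (W Q) *_)
                (trans (length-filter≡∑⟦⟧ (≡-dec _≟B_ w) (shuffle (W P) (W Q))) (count-shuffle _≟B_ w (W P) (W Q))) ⟩
      ways 0 I (W P) * ways 0 J (W Q) * ∑ (deshuffles w) (λ d → ⟦ W P ≟ʷ proj₁ d ⟧ * ⟦ W Q ≟ʷ proj₂ d ⟧)
        ≡⟨ sym (∑-*ˡ (deshuffles w) (ways 0 I (W P) * ways 0 J (W Q)) (λ d → ⟦ W P ≟ʷ proj₁ d ⟧ * ⟦ W Q ≟ʷ proj₂ d ⟧)) ⟩
      ∑ (deshuffles w) (λ d → ways 0 I (W P) * ways 0 J (W Q) * (⟦ W P ≟ʷ proj₁ d ⟧ * ⟦ W Q ≟ʷ proj₂ d ⟧))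
        ≡⟨ ∑-cong (deshuffles w) (λ d → regroup (ways 0 I (W P)) (ways 0 J (W Q)) ⟦ W P ≟ʷ proj₁ d ⟧ ⟦ W Q ≟ʷ proj₂ d ⟧) ⟩
      ∑ (deshuffles w) (λ d → left P d * right Q d)  ∎
      where
      regroup : ∀ a b c e → a * b * (c * e) ≡ c * a * (e * b)
      regroup = solve-∀

  shuffle-ways : ∀ I J R → IsComposition I → IsComposition J →
    ∑ (compositions (size I + size J)) (λ K → shCoeffComp K I J * ways 0 K (W R)) ≡
    ∑ (compositions (size I)) (λ P → ∑ (compositions (size J)) (λ Q → ways 0 I (W P) * ways 0 J (W Q) * abCoeff R P Q))
  shuffle-ways I J R isI isJ = trans (∑-shCoeff-ways I J (W R) isI isJ) (sym (∑-abCoeff-ways I J R isI isJ))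

  -- Position m of a labelling lists the sizes of the blocks whose maximum is m.
  Labelling : Set
  Labelling = List (List ℕ)

  _≟ˢ_ : DecidableEquality (List ℕ)
  _≟ˢ_ = ≡-dec _≟_

  _≟ᴸ_ : DecidableEquality Labelling
  _≟ᴸ_ = ≡-dec _≟ˢ_

  -- The analogue of ways, reading a labelling; e elements may remain open at the end.
  labelWays : ℕ → Labelling → ℕ → ℕ
  labelWays s []                        e = ⟦ s ≟ e ⟧
  labelWays s ([] ∷ μ)                  e = labelWays (suc s) μ e
  labelWays s ((_ ∷ _ ∷ _) ∷ μ)         e = 0
  labelWays s ((zero ∷ []) ∷ μ)         e = 0
  labelWays s ((suc k ∷ []) ∷ μ)        e = s choose k * labelWays (s ∸ k) μ e

  fillings : ℕ → Labelling → List Labelling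
  fillings k []            = []
  fillings k ([] ∷ μ)      = ((k ∷ []) ∷ μ) ∷ map ([] ∷_) (fillings k μ)
  fillings k ((x ∷ xs) ∷ μ) = map ((x ∷ xs) ∷_) (fillings k μ)

  length-fillings : ∀ k μ → All (λ ν → length ν ≡ length μ) (fillings k μ)
  length-fillings k []             = []
  length-fillings k ([] ∷ μ)       = refl ∷ Allₚ.map⁺ (All.map (cong suc) (length-fillings k μ))
  length-fillings k ((x ∷ xs) ∷ μ) = Allₚ.map⁺ (All.map (cong suc) (length-fillings k μ))

  choose-*-⟦∸≟0⟧ : ∀ s k → s choose k * ⟦ (s ∸ k) ≟ 0 ⟧ ≡ ⟦ s ≟ k ⟧
  choose-*-⟦∸≟0⟧ s k with k ≤? s
  ... | no  k≰s = trans (cong (_* ⟦ (s ∸ k) ≟ 0 ⟧) (n<k⇒n-choose-k≡0 (≰⇒> k≰s)))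
                        (sym (⟦⟧-no (s ≟ k) (λ s≡k → k≰s (≤-reflexive (sym s≡k)))))
  ... | yes k≤s with s ≟ k
  ...   | yes refl = trans (cong₂ _*_ (n-choose-n≡1 s) (⟦⟧-yes ((s ∸ s) ≟ 0) (n∸n≡0 s))) refl
  ...   | no  s≢k  = trans (cong (s choose k *_) (⟦⟧-no ((s ∸ k) ≟ 0) (λ s∸k≡0 → s≢k (sym (≤-antisym k≤s (m∸n≡0⇒m≤n s∸k≡0))))))
                           (*-zeroʳ (s choose k))

  -- Of the k + 1 elements open at the end, either all k + 1 were chosen from the s open
  -- at the start, or the last one to be opened is filled in with the label [k + 1].
  labelWays-open-end : ∀ μ s k → labelWays s μ (suc k) ≡
    s choose suc k * labelWays (s ∸ suc k) μ 0 + ∑ (fillings (suc k) μ) (λ ν → labelWays s ν 0)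
  labelWays-open-end []                  s k = trans (sym (choose-*-⟦∸≟0⟧ s (suc k))) (sym (+-identityʳ _))
  labelWays-open-end ([] ∷ μ)            s k = begin
    labelWays (suc s) μ (suc k)
      ≡⟨ labelWays-open-end μ (suc s) k ⟩
    suc s choose suc k * labelWays (s ∸ k) μ 0 + F (suc s)
      ≡⟨ cong (_+ F (suc s)) (*-distribʳ-+ (labelWays (s ∸ k) μ 0) (s choose k) (s choose suc k)) ⟩
    s choose k * labelWays (s ∸ k) μ 0 + s choose suc k * labelWays (s ∸ k) μ 0 + F (suc s)
      ≡⟨ cong (λ t → s choose k * labelWays (s ∸ k) μ 0 + t + F (suc s)) shift ⟩
    s choose k * labelWays (s ∸ k) μ 0 + s choose suc k * labelWays (s ∸ suc k) ([] ∷ μ) 0 + F (suc s)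
      ≡⟨ x+y+z≡y+[x+z] (s choose k * labelWays (s ∸ k) μ 0) (s choose suc k * labelWays (s ∸ suc k) ([] ∷ μ) 0) (F (suc s)) ⟩
    s choose suc k * labelWays (s ∸ suc k) ([] ∷ μ) 0 + (s choose k * labelWays (s ∸ k) μ 0 + F (suc s))
      ≡⟨ cong (λ t → s choose suc k * labelWays (s ∸ suc k) ([] ∷ μ) 0 + (s choose k * labelWays (s ∸ k) μ 0 + t))
              (sym (∑-map ([] ∷_) (fillings (suc k) μ) (λ ν → labelWays s ν 0))) ⟩
    s choose suc k * labelWays (s ∸ suc k) ([] ∷ μ) 0 + ∑ (fillings (suc k) ([] ∷ μ)) (λ ν → labelWays s ν 0)  ∎
    where
    F = λ t → ∑ (fillings (suc k) μ) (λ ν → labelWays t ν 0)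
    x+y+z≡y+[x+z] : ∀ a b c → a + b + c ≡ b + (a + c)
    x+y+z≡y+[x+z] = solve-∀
    shift : s choose suc k * labelWays (s ∸ k) μ 0 ≡ s choose suc k * labelWays (suc (s ∸ suc k)) μ 0
    shift with suc k ≤? s
    ... | yes k<s = cong (λ t → s choose suc k * labelWays t μ 0) (+-∸-assoc 1 k<s)
    ... | no  k≮s = trans (cong (_* labelWays (s ∸ k) μ 0) (n<k⇒n-choose-k≡0 (≰⇒> k≮s)))
                          (sym (cong (_* labelWays (suc (s ∸ suc k)) μ 0) (n<k⇒n-choose-k≡0 (≰⇒> k≮s))))
  labelWays-open-end ((zero ∷ []) ∷ μ)   s k = sym (cong₂ _+_ (*-zeroʳ (s choose suc k))
    (trans (∑-map ((zero ∷ []) ∷_) (fillings (suc k) μ) _) (∑-zero (fillings (suc k) μ) (λ _ → refl))))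
  labelWays-open-end ((x ∷ y ∷ xs) ∷ μ)  s k = sym (cong₂ _+_ (*-zeroʳ (s choose suc k))
    (trans (∑-map ((x ∷ y ∷ xs) ∷_) (fillings (suc k) μ) _) (∑-zero (fillings (suc k) μ) (λ _ → refl))))
  labelWays-open-end ((suc j ∷ []) ∷ μ)  s k = begin
    s choose j * labelWays (s ∸ j) μ (suc k)
      ≡⟨ cong (s choose j *_) (labelWays-open-end μ (s ∸ j) k) ⟩
    s choose j * ((s ∸ j) choose suc k * labelWays (s ∸ j ∸ suc k) μ 0 + F (s ∸ j))
      ≡⟨ *-distribˡ-+ (s choose j) _ (F (s ∸ j)) ⟩
    s choose j * ((s ∸ j) choose suc k * labelWays (s ∸ j ∸ suc k) μ 0) + s choose j * F (s ∸ j)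
      ≡⟨ cong₂ _+_ (choose-disjoint-* s j (suc k) (λ t → labelWays t μ 0)) (trans (sym (∑-*ˡ (fillings (suc k) μ) (s choose j) (λ ν → labelWays (s ∸ j) ν 0)))
                               (sym (∑-map ((suc j ∷ []) ∷_) (fillings (suc k) μ) (λ ν → labelWays s ν 0)))) ⟩
    s choose suc k * labelWays (s ∸ suc k) ((suc j ∷ []) ∷ μ) 0 + ∑ (fillings (suc k) ((suc j ∷ []) ∷ μ)) (λ ν → labelWays s ν 0)  ∎
    where
    F = λ t → ∑ (fillings (suc k) μ) (λ ν → labelWays t ν 0)

  labelWays-snoc : ∀ μ s k → labelWays s (μ ++ (suc k ∷ []) ∷ []) 0 ≡ labelWays s μ k
  labelWays-snoc []                 s k = choose-*-⟦∸≟0⟧ s k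
  labelWays-snoc ([] ∷ μ)           s k = labelWays-snoc μ (suc s) k
  labelWays-snoc ((zero ∷ []) ∷ μ)  s k = refl
  labelWays-snoc ((suc j ∷ []) ∷ μ) s k = cong (s choose j *_) (labelWays-snoc μ (s ∸ j) k)
  labelWays-snoc ((x ∷ y ∷ xs) ∷ μ) s k = refl

  labelWays-snoc-0 : ∀ μ s e → (∀ t → labelWays t (e ∷ []) 0 ≡ 0) → labelWays s (μ ++ e ∷ []) 0 ≡ 0
  labelWays-snoc-0 []                 s e e-invalid = e-invalid s
  labelWays-snoc-0 ([] ∷ μ)           s e e-invalid = labelWays-snoc-0 μ (suc s) e e-invalid
  labelWays-snoc-0 ((zero ∷ []) ∷ μ)  s e e-invalid = refl
  labelWays-snoc-0 ((suc j ∷ []) ∷ μ) s e e-invalid =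
    trans (cong (s choose j *_) (labelWays-snoc-0 μ (s ∸ j) e e-invalid)) (*-zeroʳ (s choose j))
  labelWays-snoc-0 ((x ∷ y ∷ xs) ∷ μ) s e e-invalid = refl

  ∑-fillings-0 : ∀ μ s e → ∑ (fillings 0 μ) (λ ν → labelWays s ν e) ≡ 0
  ∑-fillings-0 []                 s e = refl
  ∑-fillings-0 ([] ∷ μ)           s e = trans (∑-map ([] ∷_) (fillings 0 μ) _) (∑-fillings-0 μ (suc s) e)
  ∑-fillings-0 ((zero ∷ []) ∷ μ)  s e =
    trans (∑-map ((zero ∷ []) ∷_) (fillings 0 μ) _) (∑-zero (fillings 0 μ) (λ _ → refl))
  ∑-fillings-0 ((suc j ∷ []) ∷ μ) s e =
    trans (∑-map ((suc j ∷ []) ∷_) (fillings 0 μ) _)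
          (trans (∑-*ˡ (fillings 0 μ) (s choose j) (λ ν → labelWays (s ∸ j) ν e))
                 (trans (cong (s choose j *_) (∑-fillings-0 μ (s ∸ j) e)) (*-zeroʳ (s choose j))))
  ∑-fillings-0 ((x ∷ y ∷ xs) ∷ μ) s e =
    trans (∑-map ((x ∷ y ∷ xs) ∷_) (fillings 0 μ) _) (∑-zero (fillings 0 μ) (λ _ → refl))

  labelWays-a^k : ∀ k s (μ : Labelling) e → labelWays s (replicate k [] ++ μ) e ≡ labelWays (k + s) μ e
  labelWays-a^k zero    s μ e = refl
  labelWays-a^k (suc k) s μ e = trans (labelWays-a^k k (suc s) μ e) (cong (λ t → labelWays t μ e) (+-suc k s))

  upFrom : ℕ → ℕ → List ℕ
  upFrom k zero    = []
  upFrom k (suc n) = k ∷ upFrom (suc k) n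

  upFrom-bounds : ∀ k n → All (λ m → k ≤ m × m < k + n) (upFrom k n)
  upFrom-bounds k zero    = []
  upFrom-bounds k (suc n) = (≤-refl , ≤-<-trans (m≤m+n k n) (+-monoʳ-< k (n<1+n n)))
    ∷ All.map (λ (k<m , m<k+n) → <⇒≤ k<m , <-≤-trans m<k+n (≤-reflexive (sym (+-suc k n)))) (upFrom-bounds (suc k) n)

  upFrom-∷ʳ : ∀ k n → upFrom k (suc n) ≡ upFrom k n ++ (k + n) ∷ []
  upFrom-∷ʳ k zero    = cong (_∷ []) (sym (+-identityʳ k))
  upFrom-∷ʳ k (suc n) = cong (k ∷_) (trans (upFrom-∷ʳ (suc k) n) (cong (λ t → upFrom (suc k) n ++ t ∷ []) (sym (+-suc k n))))

  length-upFrom : ∀ k n → length (upFrom k n) ≡ n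
  length-upFrom k zero    = refl
  length-upFrom k (suc n) = cong suc (length-upFrom (suc k) n)

  ∑-upFrom-⟦≟⟧ : ∀ k n x (g : ℕ → ℕ) → k ≤ x → x < k + n → ∑ (upFrom k n) (λ m → ⟦ x ≟ m ⟧ * g m) ≡ g x
  ∑-upFrom-⟦≟⟧ k zero    x g k≤x x<k+0 = ⊥-elim (<-irrefl refl (≤-<-trans k≤x (subst (x <_) (+-identityʳ k) x<k+0)))
  ∑-upFrom-⟦≟⟧ k (suc n) x g k≤x x<k+n with x ≟ k
  ... | yes refl = trans (cong (1 * g x +_) (∑-zeroᴬ (upFrom (suc x) n)
                     (All.map (λ (x<m , _) → cong (_* _) (⟦⟧-no (x ≟ _) (<⇒≢ x<m))) (upFrom-bounds (suc x) n))))
                   (trans (+-identityʳ _) (*-identityˡ _))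
  ... | no  x≢k  = ∑-upFrom-⟦≟⟧ (suc k) n x g (≤∧≢⇒< k≤x (x≢k ∘ sym)) (subst (x <_) (+-suc k n) x<k+n)

  erase : (ℕ → List ℕ) → ℕ → ℕ → List ℕ
  erase e m0 m with m ≟ m0
  ... | yes _ = []
  ... | no  _ = e m

  erase-same : ∀ e m → erase e m m ≡ []
  erase-same e m with m ≟ m
  ... | yes _  = refl
  ... | no m≢m = ⊥-elim (m≢m refl)

  erase-other : ∀ e m0 m → m ≢ m0 → erase e m0 m ≡ e m
  erase-other e m0 m m≢m0 with m ≟ m0
  ... | yes m≡m0 = ⊥-elim (m≢m0 m≡m0)
  ... | no  _    = refl

  -- Choosing the position m whose label [k′] is erased is the same as choosing
  -- where to put [k′] into a labelling with one more empty position.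
  ∑-erase : ∀ n k (e : ℕ → List ℕ) k′ μ →
    ∑ (upFrom k n) (λ m → ⟦ map (erase e m) (upFrom k n) ≟ᴸ μ ⟧ * ⟦ e m ≟ˢ (k′ ∷ []) ⟧) ≡
    ∑ (fillings k′ μ) (λ ν → ⟦ map e (upFrom k n) ≟ᴸ ν ⟧)
  ∑-erase zero    k e k′ μ       = sym (∑-fillings-[] μ)
    where
    ∑-fillings-[] : ∀ μ → ∑ (fillings k′ μ) (λ ν → ⟦ [] ≟ᴸ ν ⟧) ≡ 0
    ∑-fillings-[] []             = refl
    ∑-fillings-[] ([] ∷ μ)       = trans (∑-map ([] ∷_) (fillings k′ μ) _) (∑-zero (fillings k′ μ) (λ _ → refl))
    ∑-fillings-[] ((x ∷ xs) ∷ μ) = trans (∑-map ((x ∷ xs) ∷_) (fillings k′ μ) _) (∑-zero (fillings k′ μ) (λ _ → refl))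
  ∑-erase (suc n) k e k′ []      = ∑-zero (upFrom k (suc n)) (λ _ → refl)
  ∑-erase (suc n) k e k′ (y ∷ μ) = trans lhs (sym (rhs y))
    where
    R = upFrom (suc k) n
    S = ∑ (fillings k′ μ) (λ ν → ⟦ map e R ≟ᴸ ν ⟧)
    later : All (λ m → k ≢ m) R
    later = All.map (λ (k<m , _) → <⇒≢ k<m) (upFrom-bounds (suc k) n)
    lhs : ∑ (upFrom k (suc n)) (λ m → ⟦ map (erase e m) (upFrom k (suc n)) ≟ᴸ (y ∷ μ) ⟧ * ⟦ e m ≟ˢ (k′ ∷ []) ⟧)
          ≡ ⟦ [] ≟ˢ y ⟧ * ⟦ map e R ≟ᴸ μ ⟧ * ⟦ e k ≟ˢ (k′ ∷ []) ⟧ + ⟦ e k ≟ˢ y ⟧ * S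
    lhs = cong₂ _+_
      (cong (_* ⟦ e k ≟ˢ (k′ ∷ []) ⟧) (trans (⟦⟧-∷ _≟ˢ_ (erase e k k) y (map (erase e k) R) μ)
        (cong₂ (λ u v → ⟦ u ≟ˢ y ⟧ * ⟦ v ≟ᴸ μ ⟧) (erase-same e k)
               (map-cong-local (All.map (λ k≢m → erase-other e k _ (k≢m ∘ sym)) later)))))
      (trans (∑-congᴬ R (All.map (λ {m} k≢m → head-fixed m k≢m) later))
             (trans (∑-*ˡ R ⟦ e k ≟ˢ y ⟧ _) (cong (⟦ e k ≟ˢ y ⟧ *_) (∑-erase n (suc k) e k′ μ))))
      where
      head-fixed : ∀ m → k ≢ m →
        ⟦ map (erase e m) (k ∷ R) ≟ᴸ (y ∷ μ) ⟧ * ⟦ e m ≟ˢ (k′ ∷ []) ⟧ ≡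
        ⟦ e k ≟ˢ y ⟧ * (⟦ map (erase e m) R ≟ᴸ μ ⟧ * ⟦ e m ≟ˢ (k′ ∷ []) ⟧)
      head-fixed m k≢m = trans
        (cong (_* ⟦ e m ≟ˢ (k′ ∷ []) ⟧) (trans (⟦⟧-∷ _≟ˢ_ (erase e m k) y (map (erase e m) R) μ)
          (cong (λ t → ⟦ t ≟ˢ y ⟧ * ⟦ map (erase e m) R ≟ᴸ μ ⟧) (erase-other e m k k≢m))))
        (*-assoc ⟦ e k ≟ˢ y ⟧ _ _)
    rhs : ∀ y → ∑ (fillings k′ (y ∷ μ)) (λ ν → ⟦ map e (k ∷ R) ≟ᴸ ν ⟧)
          ≡ ⟦ [] ≟ˢ y ⟧ * ⟦ map e R ≟ᴸ μ ⟧ * ⟦ e k ≟ˢ (k′ ∷ []) ⟧ + ⟦ e k ≟ˢ y ⟧ * S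
    rhs [] = cong₂ _+_
      (trans (⟦⟧-∷ _≟ˢ_ (e k) (k′ ∷ []) (map e R) μ)
             (trans (*-comm ⟦ e k ≟ˢ (k′ ∷ []) ⟧ _) (cong (_* ⟦ e k ≟ˢ (k′ ∷ []) ⟧) (sym (*-identityˡ ⟦ map e R ≟ᴸ μ ⟧)))))
      (trans (∑-map ([] ∷_) (fillings k′ μ) _)
             (trans (∑-cong (fillings k′ μ) (⟦⟧-∷ _≟ˢ_ (e k) [] (map e R))) (∑-*ˡ (fillings k′ μ) ⟦ e k ≟ˢ [] ⟧ _)))
    rhs (x ∷ xs) = trans (∑-map ((x ∷ xs) ∷_) (fillings k′ μ) _)
      (trans (∑-cong (fillings k′ μ) (⟦⟧-∷ _≟ˢ_ (e k) (x ∷ xs) (map e R))) (∑-*ˡ (fillings k′ μ) ⟦ e k ≟ˢ (x ∷ xs) ⟧ _))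

  -- Defs keeps the insertion step of setPartitions private; unification recovers it.
  setPartitions-step : Σ (ℕ → SetPartition → List SetPartition) λ insert →
                       ∀ n → setPartitions (suc n) ≡ concatMap (insert n) (setPartitions n)
  setPartitions-step = _ , λ _ → refl

  insert : ℕ → SetPartition → List SetPartition
  insert = proj₁ setPartitions-step

  -- Likewise for the successive differences behind Cπ: the equation Cπ-∷ determines diffs.
  mutual
    diffs : ℕ → List ℕ → List ℕ
    diffs = _

    Cπ-∷ : ∀ n π m ms → map maxB (orderedBlocks n π) ≡ m ∷ ms → Cπ n π ≡ m ∷ diffs m ms
    Cπ-∷ n π m ms maxes≡ rewrite maxes≡ = refl

  blocksAt : SetPartition → ℕ → List (List ℕ)
  blocksAt π m = filter (λ B → maxB B ≟ m) π

  sizesAt : SetPartition → ℕ → List ℕ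
  sizesAt π m = map length (blocksAt π m)

  labelling : ℕ → SetPartition → Labelling
  labelling n π = map (sizesAt π) (upFrom 1 n)

  MaxesIn : ℕ → SetPartition → Set
  MaxesIn n π = All (λ B → 1 ≤ maxB B × maxB B ≤ n) π

  Valid : ℕ → SetPartition → Set
  Valid n π = MaxesIn n π × (∀ m → length (blocksAt π m) ≤ 1)

  map-suc-upTo : ∀ n → map suc (upTo n) ≡ upFrom 1 n
  map-suc-upTo n = go (λ i → i) 0 n (λ _ → refl)
    where
    go : ∀ (f : ℕ → ℕ) k n → (∀ i → f i ≡ k + i) → map suc (applyUpTo f n) ≡ upFrom (suc k) n
    go f k zero    f≗k+ = refl
    go f k (suc n) f≗k+ = cong₂ _∷_ (cong suc (trans (f≗k+ 0) (+-identityʳ k)))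
                                    (go (f ∘ suc) (suc k) n (λ i → trans (f≗k+ (suc i)) (+-suc k i)))

  blocksAt-++ : ∀ xs ys m → blocksAt (xs ++ ys) m ≡ blocksAt xs m ++ blocksAt ys m
  blocksAt-++ xs ys m = filter-++ (λ B → maxB B ≟ m) xs ys

  blocksAt-accept : ∀ B π m → maxB B ≡ m → blocksAt (B ∷ π) m ≡ B ∷ blocksAt π m
  blocksAt-accept B π m = filter-accept (λ B → maxB B ≟ m) {B} {π}

  blocksAt-reject : ∀ B π m → maxB B ≢ m → blocksAt (B ∷ π) m ≡ blocksAt π m
  blocksAt-reject B π m = filter-reject (λ B → maxB B ≟ m) {B} {π}

  blocksAt-none : ∀ π m → All (λ B → maxB B ≢ m) π → blocksAt π m ≡ []
  blocksAt-none []      m []           = refl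
  blocksAt-none (B ∷ π) m (≢m ∷ others) = trans (blocksAt-reject B π m ≢m) (blocksAt-none π m others)

  maxB-blocksAt : ∀ π m → map maxB (blocksAt π m) ≡ replicate (length (blocksAt π m)) m
  maxB-blocksAt []      m = refl
  maxB-blocksAt (B ∷ π) m with maxB B ≟ m
  ... | yes ≡m = trans (cong (map maxB) (blocksAt-accept B π m ≡m))
      (trans (cong₂ _∷_ ≡m (maxB-blocksAt π m)) (cong (λ L → replicate (length L) m) (sym (blocksAt-accept B π m ≡m))))
  ... | no ≢m  = trans (cong (map maxB) (blocksAt-reject B π m ≢m))
      (trans (maxB-blocksAt π m) (cong (λ L → replicate (length L) m) (sym (blocksAt-reject B π m ≢m))))

  ∑-blocksAt-∷ : ∀ B π m (g : List ℕ → ℕ) → ∑ (blocksAt (B ∷ π) m) g ≡ ⟦ maxB B ≟ m ⟧ * g B + ∑ (blocksAt π m) g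
  ∑-blocksAt-∷ B π m g with maxB B ≟ m
  ... | yes ≡m = trans (cong (λ L → ∑ L g) (blocksAt-accept B π m ≡m)) (cong (_+ ∑ (blocksAt π m) g) (sym (*-identityˡ (g B))))
  ... | no ≢m  = cong (λ L → ∑ L g) (blocksAt-reject B π m ≢m)

  MaxesIn-below : ∀ n π → MaxesIn n π → All (λ B → maxB B ≢ suc n) π
  MaxesIn-below n π = All.map (λ (_ , ≤n) ≡1+n → <-irrefl ≡1+n (s≤s ≤n))

  MaxesIn-suc : ∀ n π → MaxesIn n π → MaxesIn (suc n) π
  MaxesIn-suc n π = All.map (λ (1≤ , ≤n) → 1≤ , ≤-trans ≤n (n≤1+n n))

  maxB-∷ : ∀ n B → maxB B ≤ n → maxB (suc n ∷ B) ≡ suc n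
  maxB-∷ n B ≤n = m≥n⇒m⊔n≡m (≤-trans ≤n (n≤1+n n))

  gaps : ℕ → Labelling → List ℕ
  gaps g []            = []
  gaps g ([] ∷ l)      = gaps (suc g) l
  gaps g ((_ ∷ _) ∷ l) = suc g ∷ gaps 0 l

  Kπ-labelling : ∀ n π → Kπ n π ≡ concat (labelling n π)
  Kπ-labelling n π = trans (cong (λ L → map length (concatMap (blocksAt π) L)) (map-suc-upTo n)) (go (upFrom 1 n))
    where
    go : ∀ L → map length (concatMap (blocksAt π) L) ≡ concat (map (sizesAt π) L)
    go []      = refl
    go (m ∷ L) = trans (map-++ length (blocksAt π m) (concatMap (blocksAt π) L)) (cong (sizesAt π m ++_) (go L))

  diffs-gaps : ∀ n k p (e : ℕ → List ℕ) → (∀ m → length (e m) ≤ 1) → p < k →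
    diffs p (concatMap (λ m → replicate (length (e m)) m) (upFrom k n)) ≡ gaps (k ∸ suc p) (map e (upFrom k n))
  diffs-gaps zero    k p e ≤1 p<k = refl
  diffs-gaps (suc n) k p e ≤1 p<k with e k | ≤1 k
  ... | []        | _ = trans (diffs-gaps n (suc k) p e ≤1 (≤-trans p<k (n≤1+n k)))
                              (cong (λ t → gaps t (map e (upFrom (suc k) n))) (+-∸-assoc 1 p<k))
  ... | x ∷ []    | _ = cong₂ _∷_ (+-∸-assoc 1 p<k)
                              (trans (diffs-gaps n (suc k) k e ≤1 ≤-refl) (cong (λ t → gaps t (map e (upFrom (suc k) n))) (n∸n≡0 k)))
  ... | x ∷ y ∷ _ | s≤s ()

  Cπ-labelling : ∀ n π → Valid n π → Cπ n π ≡ gaps 0 (labelling n π)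
  Cπ-labelling n π (_ , ≤1) = begin
    diffs 0 (map maxB (concatMap (blocksAt π) (map suc (upTo n))))
      ≡⟨ cong (λ L → diffs 0 (map maxB (concatMap (blocksAt π) L))) (map-suc-upTo n) ⟩
    diffs 0 (map maxB (concatMap (blocksAt π) (upFrom 1 n)))
      ≡⟨ cong (diffs 0) (go (upFrom 1 n)) ⟩
    diffs 0 (concatMap (λ m → replicate (length (sizesAt π m)) m) (upFrom 1 n))
      ≡⟨ diffs-gaps n 1 0 (sizesAt π) (λ m → subst (_≤ 1) (sym (length-map length (blocksAt π m))) (≤1 m)) (s≤s z≤n) ⟩
    gaps 0 (labelling n π)  ∎
    where
    go : ∀ L → map maxB (concatMap (blocksAt π) L) ≡ concatMap (λ m → replicate (length (sizesAt π m)) m) L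
    go []      = refl
    go (m ∷ L) = trans (map-++ maxB (blocksAt π m) (concatMap (blocksAt π) L))
      (cong₂ _++_ (trans (maxB-blocksAt π m) (cong (λ t → replicate t m) (sym (length-map length (blocksAt π m))))) (go L))

  Split : Set
  Split = SetPartition × List ℕ × SetPartition

  plug : ℕ → Split → SetPartition
  plug x (ρ₁ , B , ρ₂) = ρ₁ ++ (x ∷ B) ∷ ρ₂

  unplug : Split → SetPartition
  unplug (ρ₁ , B , ρ₂) = ρ₁ ++ B ∷ ρ₂

  splits : SetPartition → List Split
  splits []      = []
  splits (B ∷ π) = ([] , B , π) ∷ map (λ s → B ∷ proj₁ s , proj₂ s) (splits π)

  unplug-splits : ∀ π → All (λ s → unplug s ≡ π) (splits π)
  unplug-splits []      = []
  unplug-splits (B ∷ π) = refl ∷ Allₚ.map⁺ (All.map (cong (B ∷_)) (unplug-splits π))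

  ∑-splits : ∀ π (g : List ℕ → ℕ) → ∑ (splits π) (λ s → g (proj₁ (proj₂ s))) ≡ ∑ π g
  ∑-splits []      g = refl
  ∑-splits (B ∷ π) g = cong (g B +_) (trans (∑-map _ (splits π) _) (∑-splits π g))

  ∑-insert : ∀ n π (F : SetPartition → ℕ) →
    ∑ (insert n π) F ≡ F (π ++ (suc n ∷ []) ∷ []) + ∑ (splits π) (λ s → F (plug (suc n) s))
  ∑-insert n []      F = refl
  ∑-insert n (B ∷ π) F = begin
    F ((suc n ∷ B) ∷ π) + ∑ (map (B ∷_) (insert n π)) F
      ≡⟨ cong (F ((suc n ∷ B) ∷ π) +_) (trans (∑-map (B ∷_) (insert n π) F) (∑-insert n π (F ∘ (B ∷_)))) ⟩
    F ((suc n ∷ B) ∷ π) + (F (B ∷ π ++ (suc n ∷ []) ∷ []) + ∑ (splits π) (λ s → F (B ∷ plug (suc n) s)))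
      ≡⟨ x+[y+z]≡y+[x+z] (F ((suc n ∷ B) ∷ π)) (F (B ∷ π ++ (suc n ∷ []) ∷ [])) (∑ (splits π) (λ s → F (B ∷ plug (suc n) s))) ⟩
    F (B ∷ π ++ (suc n ∷ []) ∷ []) + (F ((suc n ∷ B) ∷ π) + ∑ (splits π) (λ s → F (B ∷ plug (suc n) s)))
      ≡⟨ cong (λ t → F (B ∷ π ++ (suc n ∷ []) ∷ []) + (F ((suc n ∷ B) ∷ π) + t)) (sym (∑-map _ (splits π) (λ s → F (plug (suc n) s)))) ⟩
    F (B ∷ π ++ (suc n ∷ []) ∷ []) + ∑ (splits (B ∷ π)) (λ s → F (plug (suc n) s))  ∎

  All-insert : ∀ n π (P : SetPartition → Set) → P (π ++ (suc n ∷ []) ∷ []) →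
               All (λ s → P (plug (suc n) s)) (splits π) → All P (insert n π)
  All-insert n []      P new _          = new ∷ []
  All-insert n (B ∷ π) P new (p ∷ ps)  = p ∷ Allₚ.map⁺ (All-insert n π (P ∘ (B ∷_)) new (Allₚ.map⁻ ps))

  private
    length≤1 : ∀ (xs : List (List ℕ)) y zs → length (xs ++ y ∷ zs) ≤ 1 → xs ≡ [] × zs ≡ []
    length≤1 []          y []      _          = refl , refl
    length≤1 []          y (_ ∷ _) (s≤s ())
    length≤1 (_ ∷ [])    y zs      (s≤s ())
    length≤1 (_ ∷ _ ∷ _) y zs      (s≤s ())

    length-blocksAt-∷ : ∀ B ρ m → length (blocksAt ρ m) ≤ length (blocksAt (B ∷ ρ) m)
    length-blocksAt-∷ B ρ m with maxB B ≟ m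
    ... | yes ≡m = subst (λ L → length (blocksAt ρ m) ≤ length L) (sym (blocksAt-accept B ρ m ≡m)) (n≤1+n _)
    ... | no ≢m  = subst (λ L → length (blocksAt ρ m) ≤ length L) (sym (blocksAt-reject B ρ m ≢m)) ≤-refl

  Valid-singleton : ∀ n π → Valid n π → Valid (suc n) (π ++ (suc n ∷ []) ∷ [])
  Valid-singleton n π (maxes , ≤1) = Allₚ.++⁺ (MaxesIn-suc n π maxes) ((s≤s z≤n , ≤-refl) ∷ []) , ≤1′
    where
    ≤1′ : ∀ m → length (blocksAt (π ++ (suc n ∷ []) ∷ []) m) ≤ 1
    ≤1′ m with m ≟ suc n
    ... | yes refl = subst (λ L → length L ≤ 1)
            (sym (trans (blocksAt-++ π _ (suc n)) (cong₂ _++_ (blocksAt-none π (suc n) (MaxesIn-below n π maxes))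
                                                                 (blocksAt-accept (suc n ∷ []) [] (suc n) refl)))) ≤-refl
    ... | no m≢1+n = subst (λ L → length L ≤ 1)
            (sym (trans (blocksAt-++ π _ m) (trans (cong (blocksAt π m ++_) (blocksAt-reject (suc n ∷ []) [] m (m≢1+n ∘ sym)))
                                                   (++-identityʳ (blocksAt π m))))) (≤1 m)

  Valid-plug : ∀ n s → Valid n (unplug s) → Valid (suc n) (plug (suc n) s)
  Valid-plug n (ρ₁ , B , ρ₂) (maxes , ≤1) = maxes′ , ≤1′
    where
    maxes₁ = Allₚ.++⁻ˡ ρ₁ maxes
    maxes₂ = Allₚ.++⁻ʳ ρ₁ maxes
    max≡ : maxB (suc n ∷ B) ≡ suc n
    max≡ = maxB-∷ n B (proj₂ (All.head maxes₂))
    maxes′ : MaxesIn (suc n) (ρ₁ ++ (suc n ∷ B) ∷ ρ₂)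
    maxes′ = Allₚ.++⁺ (MaxesIn-suc n ρ₁ maxes₁)
                      ((subst (1 ≤_) (sym max≡) (s≤s z≤n) , ≤-reflexive max≡) ∷ MaxesIn-suc n ρ₂ (All.tail maxes₂))
    ≤1′ : ∀ m → length (blocksAt (ρ₁ ++ (suc n ∷ B) ∷ ρ₂) m) ≤ 1
    ≤1′ m with m ≟ suc n
    ... | yes refl = subst (λ L → length L ≤ 1)
            (sym (trans (blocksAt-++ ρ₁ _ (suc n)) (cong₂ _++_ (blocksAt-none ρ₁ (suc n) (MaxesIn-below n ρ₁ maxes₁))
                 (trans (blocksAt-accept (suc n ∷ B) ρ₂ (suc n) max≡)
                        (cong ((suc n ∷ B) ∷_) (blocksAt-none ρ₂ (suc n) (MaxesIn-below n ρ₂ (All.tail maxes₂))))))))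
            ≤-refl
    ... | no m≢1+n = subst (λ L → length L ≤ 1)
            (sym (trans (blocksAt-++ ρ₁ _ m) (cong (blocksAt ρ₁ m ++_) (blocksAt-reject (suc n ∷ B) ρ₂ m (λ e → m≢1+n (trans (sym e) max≡))))))
            (≤-trans (subst (_≤ length (blocksAt ρ₁ m ++ blocksAt (B ∷ ρ₂) m)) (sym (length-++ (blocksAt ρ₁ m)))
                            (subst (length (blocksAt ρ₁ m) + length (blocksAt ρ₂ m) ≤_) (sym (length-++ (blocksAt ρ₁ m)))
                                   (+-monoʳ-≤ (length (blocksAt ρ₁ m)) (length-blocksAt-∷ B ρ₂ m))))
                     (subst (λ L → length L ≤ 1) (blocksAt-++ ρ₁ (B ∷ ρ₂) m) (≤1 m)))

  setPartitions-Valid : ∀ n → All (Valid n) (setPartitions n)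
  setPartitions-Valid zero    = ([] , (λ _ → z≤n)) ∷ []
  setPartitions-Valid (suc n) = Allₚ.concat⁺ (Allₚ.map⁺ (All.map insert-Valid (setPartitions-Valid n)))
    where
    insert-Valid : ∀ {π} → Valid n π → All (Valid (suc n)) (insert n π)
    insert-Valid {π} valid = All-insert n π (Valid (suc n)) (Valid-singleton n π valid)
      (All.map (λ {s} unplug≡π → Valid-plug n s (subst (Valid n) (sym unplug≡π) valid)) (unplug-splits π))

  labelling-suc : ∀ n π → labelling (suc n) π ≡ map (sizesAt π) (upFrom 1 n) ++ sizesAt π (suc n) ∷ []
  labelling-suc n π = trans (cong (map (sizesAt π)) (upFrom-∷ʳ 1 n)) (map-++ (sizesAt π) (upFrom 1 n) (suc n ∷ []))

  upFrom-1-≤ : ∀ n → All (_≤ n) (upFrom 1 n)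
  upFrom-1-≤ n = All.map (λ (_ , m<1+n) → s≤s⁻¹ m<1+n) (upFrom-bounds 1 n)

  labelling-singleton : ∀ n π → Valid n π → labelling (suc n) (π ++ (suc n ∷ []) ∷ []) ≡ labelling n π ++ (1 ∷ []) ∷ []
  labelling-singleton n π (maxes , _) =
    trans (labelling-suc n π′) (cong₂ _++_ (map-cong-local (All.map (λ {m} → unchanged m) (upFrom-1-≤ n))) (cong (_∷ []) new))
    where
    π′ = π ++ (suc n ∷ []) ∷ []
    unchanged : ∀ m → m ≤ n → sizesAt π′ m ≡ sizesAt π m
    unchanged m m≤n = cong (map length) (trans (blocksAt-++ π _ m)
      (trans (cong (blocksAt π m ++_) (blocksAt-reject (suc n ∷ []) [] m (λ e → <-irrefl (sym e) (s≤s m≤n))))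
             (++-identityʳ (blocksAt π m))))
    new : sizesAt π′ (suc n) ≡ 1 ∷ []
    new = cong (map length) (trans (blocksAt-++ π _ (suc n))
      (cong₂ _++_ (blocksAt-none π (suc n) (MaxesIn-below n π maxes)) (blocksAt-accept (suc n ∷ []) [] (suc n) refl)))

  labelling-plug : ∀ n s → Valid n (unplug s) →
    labelling (suc n) (plug (suc n) s) ≡
    map (erase (sizesAt (unplug s)) (maxB (proj₁ (proj₂ s)))) (upFrom 1 n) ++ (suc (length (proj₁ (proj₂ s))) ∷ []) ∷ []
  labelling-plug n (ρ₁ , B , ρ₂) (maxes , ≤1) =
    trans (labelling-suc n π′) (cong₂ _++_ (map-cong-local (All.map (λ {m} → changed m) (upFrom-1-≤ n))) (cong (_∷ []) new))
    where
    π = ρ₁ ++ B ∷ ρ₂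
    π′ = ρ₁ ++ (suc n ∷ B) ∷ ρ₂
    maxes₁ = Allₚ.++⁻ˡ ρ₁ maxes
    maxes₂ = Allₚ.++⁻ʳ ρ₁ maxes
    max≡ : maxB (suc n ∷ B) ≡ suc n
    max≡ = maxB-∷ n B (proj₂ (All.head maxes₂))
    below : ∀ m → m ≤ n → blocksAt π′ m ≡ blocksAt ρ₁ m ++ blocksAt ρ₂ m
    below m m≤n = trans (blocksAt-++ ρ₁ _ m)
      (cong (blocksAt ρ₁ m ++_) (blocksAt-reject (suc n ∷ B) ρ₂ m (λ e → <-irrefl (trans (sym e) max≡) (s≤s m≤n))))
    changed : ∀ m → m ≤ n → sizesAt π′ m ≡ erase (sizesAt π) (maxB B) m
    changed m m≤n with m ≟ maxB B
    ... | yes refl = cong (map length) (trans (below m m≤n) (cong₂ _++_ (proj₁ alone) (proj₂ alone)))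
      where
      alone : blocksAt ρ₁ m ≡ [] × blocksAt ρ₂ m ≡ []
      alone = length≤1 (blocksAt ρ₁ m) B (blocksAt ρ₂ m)
        (subst (λ L → length L ≤ 1) (trans (blocksAt-++ ρ₁ (B ∷ ρ₂) m) (cong (blocksAt ρ₁ m ++_) (blocksAt-accept B ρ₂ m refl))) (≤1 m))
    ... | no m≢max = trans (cong (map length) (trans (below m m≤n) (cong (blocksAt ρ₁ m ++_) (sym (blocksAt-reject B ρ₂ m (m≢max ∘ sym))))))
                           (cong (map length) (sym (blocksAt-++ ρ₁ (B ∷ ρ₂) m)))
    new : sizesAt π′ (suc n) ≡ suc (length B) ∷ []
    new = cong (map length) (trans (blocksAt-++ ρ₁ _ (suc n)) (cong₂ _++_ (blocksAt-none ρ₁ (suc n) (MaxesIn-below n ρ₁ maxes₁))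
      (trans (blocksAt-accept (suc n ∷ B) ρ₂ (suc n) max≡) (cong ((suc n ∷ B) ∷_) (blocksAt-none ρ₂ (suc n) (MaxesIn-below n ρ₂ (All.tail maxes₂)))))))

  ∑-blocks-by-max : ∀ n π (h : ℕ → List ℕ → ℕ) → MaxesIn n π →
    ∑ π (λ B → h (maxB B) B) ≡ ∑ (upFrom 1 n) (λ m → ∑ (blocksAt π m) (h m))
  ∑-blocks-by-max n []      h []                 = sym (∑-zero (upFrom 1 n) (λ _ → refl))
  ∑-blocks-by-max n (B ∷ π) h ((1≤ , ≤n) ∷ maxes) = begin
    h (maxB B) B + ∑ π (λ C → h (maxB C) C)
      ≡⟨ cong₂ _+_ (sym (∑-upFrom-⟦≟⟧ 1 n (maxB B) (λ m → h m B) 1≤ (s≤s ≤n))) (∑-blocks-by-max n π h maxes) ⟩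
    ∑ (upFrom 1 n) (λ m → ⟦ maxB B ≟ m ⟧ * h m B) + ∑ (upFrom 1 n) (λ m → ∑ (blocksAt π m) (h m))
      ≡⟨ sym (∑-+ (upFrom 1 n) _ _) ⟩
    ∑ (upFrom 1 n) (λ m → ⟦ maxB B ≟ m ⟧ * h m B + ∑ (blocksAt π m) (h m))
      ≡⟨ ∑-cong (upFrom 1 n) (λ m → sym (∑-blocksAt-∷ B π m (h m))) ⟩
    ∑ (upFrom 1 n) (λ m → ∑ (blocksAt (B ∷ π) m) (h m))  ∎

  ⟦⟧-∷ʳ : ∀ (l m : Labelling) x y → length l ≡ length m →
          ⟦ (l ++ x ∷ []) ≟ᴸ (m ++ y ∷ []) ⟧ ≡ ⟦ l ≟ᴸ m ⟧ * ⟦ x ≟ˢ y ⟧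
  ⟦⟧-∷ʳ []      []      x y _ = trans (⟦⟧-∷ _≟ˢ_ x y [] []) (*-comm ⟦ x ≟ˢ y ⟧ 1)
  ⟦⟧-∷ʳ (a ∷ l) (b ∷ m) x y |l|≡|m| = begin
    ⟦ (a ∷ l ++ x ∷ []) ≟ᴸ (b ∷ m ++ y ∷ []) ⟧        ≡⟨ ⟦⟧-∷ _≟ˢ_ a b (l ++ x ∷ []) (m ++ y ∷ []) ⟩
    ⟦ a ≟ˢ b ⟧ * ⟦ (l ++ x ∷ []) ≟ᴸ (m ++ y ∷ []) ⟧  ≡⟨ cong (⟦ a ≟ˢ b ⟧ *_) (⟦⟧-∷ʳ l m x y (suc-injective |l|≡|m|)) ⟩
    ⟦ a ≟ˢ b ⟧ * (⟦ l ≟ᴸ m ⟧ * ⟦ x ≟ˢ y ⟧)            ≡⟨ sym (*-assoc ⟦ a ≟ˢ b ⟧ _ _) ⟩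
    ⟦ a ≟ˢ b ⟧ * ⟦ l ≟ᴸ m ⟧ * ⟦ x ≟ˢ y ⟧              ≡⟨ cong (_* ⟦ x ≟ˢ y ⟧) (sym (⟦⟧-∷ _≟ˢ_ a b l m)) ⟩
    ⟦ (a ∷ l) ≟ᴸ (b ∷ m) ⟧ * ⟦ x ≟ˢ y ⟧               ∎

  length-map-upFrom : ∀ n (f : ℕ → List ℕ) → length (map f (upFrom 1 n)) ≡ n
  length-map-upFrom n f = trans (length-map f (upFrom 1 n)) (length-upFrom 1 n)

  -- Inserting n + 1 either as a singleton (label [1]) or into a block B with maximum m,
  -- which moves the label [|B|] from position m to the label [|B| + 1] at n + 1.
  ∑-insert-labelling : ∀ n π μ y → Valid n π → length μ ≡ n →
    ∑ (insert n π) (λ π′ → ⟦ labelling (suc n) π′ ≟ᴸ (μ ++ y ∷ []) ⟧) ≡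
    ⟦ labelling n π ≟ᴸ μ ⟧ * ⟦ (1 ∷ []) ≟ˢ y ⟧ +
    ∑ (upFrom 1 n) (λ m → ⟦ map (erase (sizesAt π) m) (upFrom 1 n) ≟ᴸ μ ⟧ * ∑ (sizesAt π m) (λ ℓ → ⟦ (suc ℓ ∷ []) ≟ˢ y ⟧))
  ∑-insert-labelling n π μ y valid |μ|≡n = begin
    ∑ (insert n π) F
      ≡⟨ ∑-insert n π F ⟩
    F (π ++ (suc n ∷ []) ∷ []) + ∑ (splits π) (λ s → F (plug (suc n) s))
      ≡⟨ cong₂ _+_ (trans (cong (λ l → ⟦ l ≟ᴸ (μ ++ y ∷ []) ⟧) (labelling-singleton n π valid))
                          (⟦⟧-∷ʳ (labelling n π) μ (1 ∷ []) y (trans (length-map-upFrom n (sizesAt π)) (sym |μ|≡n))))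
                   (∑-congᴬ (splits π) (All.map (λ {s} → plugged s) (unplug-splits π))) ⟩
    ⟦ labelling n π ≟ᴸ μ ⟧ * ⟦ (1 ∷ []) ≟ˢ y ⟧ + ∑ (splits π) (λ s → h (maxB (proj₁ (proj₂ s))) (proj₁ (proj₂ s)))
      ≡⟨ cong (⟦ labelling n π ≟ᴸ μ ⟧ * ⟦ (1 ∷ []) ≟ˢ y ⟧ +_)
              (trans (∑-splits π (λ B → h (maxB B) B)) (∑-blocks-by-max n π h (proj₁ valid))) ⟩
    ⟦ labelling n π ≟ᴸ μ ⟧ * ⟦ (1 ∷ []) ≟ˢ y ⟧ + ∑ (upFrom 1 n) (λ m → ∑ (blocksAt π m) (h m))
      ≡⟨ cong (⟦ labelling n π ≟ᴸ μ ⟧ * ⟦ (1 ∷ []) ≟ˢ y ⟧ +_) (∑-cong (upFrom 1 n) (λ m →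
           trans (∑-*ˡ (blocksAt π m) (erased m) (λ B → ⟦ (suc (length B) ∷ []) ≟ˢ y ⟧))
                 (cong (erased m *_) (sym (∑-map length (blocksAt π m) (λ ℓ → ⟦ (suc ℓ ∷ []) ≟ˢ y ⟧)))))) ⟩
    ⟦ labelling n π ≟ᴸ μ ⟧ * ⟦ (1 ∷ []) ≟ˢ y ⟧ + ∑ (upFrom 1 n) (λ m → erased m * ∑ (sizesAt π m) (λ ℓ → ⟦ (suc ℓ ∷ []) ≟ˢ y ⟧))  ∎
    where
    F : SetPartition → ℕ
    F π′ = ⟦ labelling (suc n) π′ ≟ᴸ (μ ++ y ∷ []) ⟧
    erased : ℕ → ℕ
    erased m = ⟦ map (erase (sizesAt π) m) (upFrom 1 n) ≟ᴸ μ ⟧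
    h : ℕ → List ℕ → ℕ
    h m B = erased m * ⟦ (suc (length B) ∷ []) ≟ˢ y ⟧
    plugged : ∀ s → unplug s ≡ π → F (plug (suc n) s) ≡ h (maxB (proj₁ (proj₂ s))) (proj₁ (proj₂ s))
    plugged s refl = trans (cong (λ l → ⟦ l ≟ᴸ (μ ++ y ∷ []) ⟧) (labelling-plug n s valid))
      (⟦⟧-∷ʳ (map (erase (sizesAt π) (maxB (proj₁ (proj₂ s)))) (upFrom 1 n)) μ _ y
             (trans (length-map-upFrom n _) (sym |μ|≡n)))

  ∑-sizes-⟦⟧ : ∀ (L : List ℕ) k → length L ≤ 1 → ∑ L (λ ℓ → ⟦ (suc ℓ ∷ []) ≟ˢ (suc k ∷ []) ⟧) ≡ ⟦ L ≟ˢ (k ∷ []) ⟧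
  ∑-sizes-⟦⟧ []          k _ = refl
  ∑-sizes-⟦⟧ (ℓ ∷ [])    k _ = trans (+-identityʳ _) (⟦⟧-⇔ ((suc ℓ ∷ []) ≟ˢ (suc k ∷ [])) ((ℓ ∷ []) ≟ˢ (k ∷ []))
    (λ e → cong (_∷ []) (suc-injective (proj₁ (∷-injective e)))) (λ e → cong (λ t → suc t ∷ []) (proj₁ (∷-injective e))))
  ∑-sizes-⟦⟧ (ℓ ∷ _ ∷ _) k (s≤s ())

  IsLabel : List ℕ → Set
  IsLabel y = Σ ℕ λ k → y ≡ suc k ∷ []

  labelWays-non-label : ∀ y → ¬ IsLabel y → ∀ t → labelWays t (y ∷ []) 0 ≡ 0
  labelWays-non-label []              _     t = refl
  labelWays-non-label (zero ∷ [])     _     t = refl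
  labelWays-non-label (suc k ∷ [])    ¬lab  t = ⊥-elim (¬lab (k , refl))
  labelWays-non-label (_ ∷ _ ∷ _)     _     t = refl

  CountsLabellings : ℕ → Set
  CountsLabellings n = ∀ μ → length μ ≡ n → ∑ (setPartitions n) (λ π → ⟦ labelling n π ≟ᴸ μ ⟧) ≡ labelWays 0 μ 0

  module _ (n : ℕ) (counts : CountsLabellings n) (μ : Labelling) (|μ|≡n : length μ ≡ n) where

    private
      SP = setPartitions n
      inserted : List ℕ → SetPartition → ℕ
      inserted y π = ⟦ labelling n π ≟ᴸ μ ⟧ * ⟦ (1 ∷ []) ≟ˢ y ⟧ +
        ∑ (upFrom 1 n) (λ m → ⟦ map (erase (sizesAt π) m) (upFrom 1 n) ≟ᴸ μ ⟧ * ∑ (sizesAt π m) (λ ℓ → ⟦ (suc ℓ ∷ []) ≟ˢ y ⟧))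

    ∑-inserted-label : ∀ k → ∑ SP (inserted (suc k ∷ [])) ≡
                       labelWays 0 μ 0 * ⟦ (1 ∷ []) ≟ˢ (suc k ∷ []) ⟧ + ∑ (fillings k μ) (λ ν → labelWays 0 ν 0)
    ∑-inserted-label k = begin
      ∑ SP (inserted (suc k ∷ []))
        ≡⟨ ∑-congᴬ SP (All.map (λ {π} (_ , ≤1) → cong (⟦ labelling n π ≟ᴸ μ ⟧ * ⟦ (1 ∷ []) ≟ˢ (suc k ∷ []) ⟧ +_)
              (trans (∑-cong (upFrom 1 n) (λ m → cong (⟦ map (erase (sizesAt π) m) (upFrom 1 n) ≟ᴸ μ ⟧ *_)
                        (∑-sizes-⟦⟧ (sizesAt π m) k (subst (_≤ 1) (sym (length-map length (blocksAt π m))) (≤1 m)))))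
                     (∑-erase n 1 (sizesAt π) k μ))) (setPartitions-Valid n)) ⟩
      ∑ SP (λ π → ⟦ labelling n π ≟ᴸ μ ⟧ * ⟦ (1 ∷ []) ≟ˢ (suc k ∷ []) ⟧ + ∑ (fillings k μ) (λ ν → ⟦ labelling n π ≟ᴸ ν ⟧))
        ≡⟨ ∑-+ SP _ _ ⟩
      ∑ SP (λ π → ⟦ labelling n π ≟ᴸ μ ⟧ * ⟦ (1 ∷ []) ≟ˢ (suc k ∷ []) ⟧) + ∑ SP (λ π → ∑ (fillings k μ) (λ ν → ⟦ labelling n π ≟ᴸ ν ⟧))
        ≡⟨ cong₂ _+_ (trans (∑-*ʳ SP _ (λ π → ⟦ labelling n π ≟ᴸ μ ⟧)) (cong (_* _) (counts μ |μ|≡n)))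
                     (trans (∑-swap SP (fillings k μ) (λ π ν → ⟦ labelling n π ≟ᴸ ν ⟧))
                            (∑-congᴬ (fillings k μ) (All.map (λ {ν} |ν|≡ → counts ν (trans |ν|≡ |μ|≡n)) (length-fillings k μ)))) ⟩
      labelWays 0 μ 0 * ⟦ (1 ∷ []) ≟ˢ (suc k ∷ []) ⟧ + ∑ (fillings k μ) (λ ν → labelWays 0 ν 0)  ∎

    ∑-inserted-non-label : ∀ y → ¬ IsLabel y → ∑ SP (inserted y) ≡ labelWays 0 (μ ++ y ∷ []) 0
    ∑-inserted-non-label y ¬lab = trans (∑-zero SP (λ π → cong₂ _+_
        (trans (cong (⟦ labelling n π ≟ᴸ μ ⟧ *_) (⟦⟧-no ((1 ∷ []) ≟ˢ y) (λ e → ¬lab (0 , sym e)))) (*-zeroʳ ⟦ labelling n π ≟ᴸ μ ⟧))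
        (∑-zero (upFrom 1 n) (λ m → trans (cong (⟦ map (erase (sizesAt π) m) (upFrom 1 n) ≟ᴸ μ ⟧ *_)
                                               (∑-zero (sizesAt π m) (λ ℓ → ⟦⟧-no ((suc ℓ ∷ []) ≟ˢ y) (λ e → ¬lab (ℓ , sym e)))))
                                          (*-zeroʳ ⟦ map (erase (sizesAt π) m) (upFrom 1 n) ≟ᴸ μ ⟧)))))
      (sym (labelWays-snoc-0 μ 0 y (labelWays-non-label y ¬lab)))

    ∑-inserted : ∀ y → ∑ SP (inserted y) ≡ labelWays 0 (μ ++ y ∷ []) 0
    ∑-inserted (suc zero ∷ [])    = begin
      ∑ SP (inserted (1 ∷ []))                                         ≡⟨ ∑-inserted-label 0 ⟩
      labelWays 0 μ 0 * 1 + ∑ (fillings 0 μ) (λ ν → labelWays 0 ν 0)  ≡⟨ cong₂ _+_ (*-identityʳ (labelWays 0 μ 0)) (∑-fillings-0 μ 0 0) ⟩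
      labelWays 0 μ 0 + 0                                              ≡⟨ +-identityʳ _ ⟩
      labelWays 0 μ 0                                                  ≡⟨ sym (labelWays-snoc μ 0 0) ⟩
      labelWays 0 (μ ++ (1 ∷ []) ∷ []) 0                               ∎
    ∑-inserted (suc (suc k) ∷ []) = begin
      ∑ SP (inserted (suc (suc k) ∷ []))                                           ≡⟨ ∑-inserted-label (suc k) ⟩
      labelWays 0 μ 0 * 0 + ∑ (fillings (suc k) μ) (λ ν → labelWays 0 ν 0)        ≡⟨ cong (_+ ∑ (fillings (suc k) μ) (λ ν → labelWays 0 ν 0)) (*-zeroʳ (labelWays 0 μ 0)) ⟩
      0 choose suc k * labelWays 0 μ 0 + ∑ (fillings (suc k) μ) (λ ν → labelWays 0 ν 0) ≡⟨ sym (labelWays-open-end μ 0 k) ⟩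
      labelWays 0 μ (suc k)                                                        ≡⟨ sym (labelWays-snoc μ 0 (suc k)) ⟩
      labelWays 0 (μ ++ (suc (suc k) ∷ []) ∷ []) 0                                 ∎
    ∑-inserted []                 = ∑-inserted-non-label [] λ ()
    ∑-inserted (zero ∷ [])        = ∑-inserted-non-label (zero ∷ []) λ ()
    ∑-inserted (_ ∷ _ ∷ _)        = ∑-inserted-non-label _ λ ()

    counts-∷ʳ : ∀ y → ∑ (setPartitions (suc n)) (λ π → ⟦ labelling (suc n) π ≟ᴸ (μ ++ y ∷ []) ⟧) ≡ labelWays 0 (μ ++ y ∷ []) 0
    counts-∷ʳ y = trans (∑-concatMap (insert n) SP _)
      (trans (∑-congᴬ SP (All.map (λ {π} valid → ∑-insert-labelling n π μ y valid |μ|≡n) (setPartitions-Valid n)))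
             (∑-inserted y))

  count-labellings : ∀ n → CountsLabellings n
  count-labellings zero    []      _       = refl
  count-labellings (suc n) μ       |μ|≡1+n with initLast μ
  ... | μ′ ∷ʳ′ y = counts-∷ʳ n (count-labellings n) μ′ |μ′|≡n y
    where
    |μ′|≡n : length μ′ ≡ n
    |μ′|≡n = suc-injective (trans (trans (+-comm 1 (length μ′)) (sym (length-++ μ′))) |μ|≡1+n)

  -- the labelling of any set partition with K(π) = I and C(π) = J; when I and J have
  -- different lengths there is none, and the result is a labelling of weight 0
  labellingOf : Composition → Composition → Labelling
  labellingOf []      []      = []
  labellingOf (i ∷ I) (j ∷ J) = replicate (pred j) [] ++ (i ∷ []) ∷ labellingOf I J
  labellingOf []      (_ ∷ _) = (0 ∷ 0 ∷ []) ∷ []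
  labellingOf (_ ∷ _) []      = (0 ∷ 0 ∷ []) ∷ []

  AtMostOne : Labelling → Set
  AtMostOne = All (λ e → length e ≤ 1)

  labelling-AtMostOne : ∀ n π → Valid n π → AtMostOne (labelling n π)
  labelling-AtMostOne n π (_ , ≤1) =
    Allₚ.map⁺ (All.universal (λ m → subst (_≤ 1) (sym (length-map length (blocksAt π m))) (≤1 m)) (upFrom 1 n))

  labellingOf-gaps : ∀ l g → AtMostOne l → g + length l ≡ size (gaps g l) →
                     replicate g [] ++ l ≡ labellingOf (concat l) (gaps g l)
  labellingOf-gaps []               zero    _              _ = refl
  labellingOf-gaps ([] ∷ l)         g       (_ ∷ l≤1)      g+|l|≡ =
    trans (a^g-a g l) (labellingOf-gaps l (suc g) l≤1 (trans (sym (+-suc g (length l))) g+|l|≡))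
    where
    a^g-a : ∀ g (l : Labelling) → replicate g [] ++ [] ∷ l ≡ replicate (suc g) [] ++ l
    a^g-a zero    l = refl
    a^g-a (suc g) l = cong ([] ∷_) (a^g-a g l)
  labellingOf-gaps ((x ∷ []) ∷ l)   g       (_ ∷ l≤1)      g+|l|≡ =
    cong (λ t → replicate g [] ++ (x ∷ []) ∷ t)
         (labellingOf-gaps l 0 l≤1 (+-cancelˡ-≡ (suc g) (length l) _ (trans (sym (+-suc g (length l))) g+|l|≡)))
  labellingOf-gaps ((_ ∷ _ ∷ _) ∷ l) g       (s≤s () ∷ _)   _

  gaps-a^k : ∀ k g (μ : Labelling) → gaps g (replicate k [] ++ μ) ≡ gaps (k + g) μ
  gaps-a^k zero    g μ = refl
  gaps-a^k (suc k) g μ = trans (gaps-a^k k (suc g) μ) (cong (λ t → gaps t μ) (+-suc k g))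

  concat-a^k : ∀ k (μ : Labelling) → concat (replicate k [] ++ μ) ≡ concat μ
  concat-a^k zero    μ = refl
  concat-a^k (suc k) μ = concat-a^k k μ

  labellingOf-inverse : ∀ I J → IsComposition J → AtMostOne (labellingOf I J) →
                        concat (labellingOf I J) ≡ I × gaps 0 (labellingOf I J) ≡ J
  labellingOf-inverse []      []          _         _ = refl , refl
  labellingOf-inverse (i ∷ I) (suc j ∷ J) (_ ∷ isJ) ≤1 with labellingOf-inverse I J isJ (All.tail (Allₚ.++⁻ʳ (replicate j []) ≤1))
  ... | concat≡I , gaps≡J = trans (concat-a^k j _) (cong (i ∷_) concat≡I) ,
                            trans (gaps-a^k j 0 _) (cong₂ _∷_ (cong suc (+-identityʳ j)) gaps≡J)
  labellingOf-inverse []      (_ ∷ _)     _         (s≤s () ∷ _)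
  labellingOf-inverse (_ ∷ _) []          _         (s≤s () ∷ _)

  length-labellingOf : ∀ I J → IsComposition J → AtMostOne (labellingOf I J) → length (labellingOf I J) ≡ size J
  length-labellingOf []      []          _         _  = refl
  length-labellingOf (i ∷ I) (suc j ∷ J) (_ ∷ isJ) ≤1 = begin
    length (replicate j [] ++ (i ∷ []) ∷ labellingOf I J)    ≡⟨ length-++ (replicate j []) ⟩
    length (replicate j []) + suc (length (labellingOf I J))
      ≡⟨ cong₂ _+_ (length-replicate j) (cong suc (length-labellingOf I J isJ (All.tail (Allₚ.++⁻ʳ (replicate j []) ≤1)))) ⟩
    j + suc (size J)                                         ≡⟨ +-suc j (size J) ⟩
    suc j + size J                                           ∎
  length-labellingOf []      (_ ∷ _)     _         (s≤s () ∷ _)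
  length-labellingOf (_ ∷ _) []          _         (s≤s () ∷ _)

  labelWays-¬AtMostOne : ∀ l s e → ¬ AtMostOne l → labelWays s l e ≡ 0
  labelWays-¬AtMostOne []                 s e ¬≤1 = ⊥-elim (¬≤1 [])
  labelWays-¬AtMostOne ([] ∷ l)           s e ¬≤1 = labelWays-¬AtMostOne l (suc s) e (¬≤1 ∘ (z≤n ∷_))
  labelWays-¬AtMostOne ((_ ∷ _ ∷ _) ∷ l)  s e ¬≤1 = refl
  labelWays-¬AtMostOne ((zero ∷ []) ∷ l)  s e ¬≤1 = refl
  labelWays-¬AtMostOne ((suc k ∷ []) ∷ l) s e ¬≤1 =
    trans (cong (s choose k *_) (labelWays-¬AtMostOne l (s ∸ k) e (¬≤1 ∘ (s≤s z≤n ∷_)))) (*-zeroʳ (s choose k))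

  labelWays-labellingOf : ∀ s I J → IsComposition I → IsComposition J → labelWays s (labellingOf I J) 0 ≡ ways s I (W J)
  labelWays-labellingOf zero    []          []          _         _         = refl
  labelWays-labellingOf (suc s) []          []          _         _         = refl
  labelWays-labellingOf s       []          (suc j ∷ J) _         _         = sym (ways-a^k j s [] (true ∷ W J))
  labelWays-labellingOf s       []          (zero ∷ J)  _         (() ∷ _)
  labelWays-labellingOf s       (i ∷ I)     []          _         _         = refl
  labelWays-labellingOf s       (zero ∷ I)  (_ ∷ _)     (() ∷ _)  _
  labelWays-labellingOf s       (suc i ∷ I) (zero ∷ J)  _         (() ∷ _)
  labelWays-labellingOf s       (suc i ∷ I) (suc j ∷ J) (_ ∷ isI) (_ ∷ isJ) = begin
    labelWays s (replicate j [] ++ (suc i ∷ []) ∷ labellingOf I J) 0  ≡⟨ labelWays-a^k j s _ 0 ⟩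
    (j + s) choose i * labelWays (j + s ∸ i) (labellingOf I J) 0      ≡⟨ cong ((j + s) choose i *_) (labelWays-labellingOf (j + s ∸ i) I J isI isJ) ⟩
    (j + s) choose i * ways (j + s ∸ i) I (W J)                        ≡⟨ sym (ways-a^k j s (suc i ∷ I) (true ∷ W J)) ⟩
    ways s (suc i ∷ I) (W (suc j ∷ J))                                 ∎

  cIJ≡ways : ∀ I J → IsComposition I → IsComposition J → size J ≡ size I → cIJ I J ≡ ways 0 I (W J)
  cIJ≡ways I J isI isJ |J|≡|I| = begin
    cIJ I J
      ≡⟨ length-filter≡∑⟦⟧ (λ π → (Kπ n π ≟ˢ I) ×-dec (Cπ n π ≟ˢ J)) (setPartitions n) ⟩
    ∑ (setPartitions n) (λ π → ⟦ (Kπ n π ≟ˢ I) ×-dec (Cπ n π ≟ˢ J) ⟧)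
      ≡⟨ ∑-congᴬ (setPartitions n) (All.map (λ {π} valid → ⟦⟧-⇔ _ _ (to π valid) (from π valid)) (setPartitions-Valid n)) ⟩
    ∑ (setPartitions n) (λ π → ⟦ labelling n π ≟ᴸ labellingOf I J ⟧)
      ≡⟨ counted (All.all? (λ e → length e ≤? 1) (labellingOf I J)) ⟩
    labelWays 0 (labellingOf I J) 0
      ≡⟨ labelWays-labellingOf 0 I J isI isJ ⟩
    ways 0 I (W J)  ∎
    where
    n = size I
    to : ∀ π → Valid n π → Kπ n π ≡ I × Cπ n π ≡ J → labelling n π ≡ labellingOf I J
    to π valid (K≡I , C≡J) = trans
      (labellingOf-gaps (labelling n π) 0 (labelling-AtMostOne n π valid)
        (trans (length-map-upFrom n (sizesAt π)) (trans (sym |J|≡|I|) (cong size (sym (trans (sym (Cπ-labelling n π valid)) C≡J))))))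
      (cong₂ labellingOf (trans (sym (Kπ-labelling n π)) K≡I) (trans (sym (Cπ-labelling n π valid)) C≡J))
    from : ∀ π → Valid n π → labelling n π ≡ labellingOf I J → Kπ n π ≡ I × Cπ n π ≡ J
    from π valid l≡ with labellingOf-inverse I J isJ (subst AtMostOne l≡ (labelling-AtMostOne n π valid))
    ... | concat≡I , gaps≡J = trans (Kπ-labelling n π) (trans (cong concat l≡) concat≡I) ,
                              trans (Cπ-labelling n π valid) (trans (cong (gaps 0) l≡) gaps≡J)
    counted : Dec (AtMostOne (labellingOf I J)) →
              ∑ (setPartitions n) (λ π → ⟦ labelling n π ≟ᴸ labellingOf I J ⟧) ≡ labelWays 0 (labellingOf I J) 0
    counted (yes ≤1) = count-labellings n (labellingOf I J) (trans (length-labellingOf I J isJ ≤1) |J|≡|I|)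
    counted (no ¬≤1) = trans
      (∑-zeroᴬ (setPartitions n) (All.map (λ {π} valid → ⟦⟧-no (labelling n π ≟ᴸ labellingOf I J)
                                                            (λ l≡ → ¬≤1 (subst AtMostOne l≡ (labelling-AtMostOne n π valid))))
                                          (setPartitions-Valid n)))
      (sym (labelWays-¬AtMostOne (labellingOf I J) 0 0 ¬≤1))

  -- the sum of the partial sums i₁, i₁ + i₂, …, of I
  partialSumsTotal : Composition → ℕ
  partialSumsTotal []      = 0
  partialSumsTotal (p ∷ P) = p * suc (length P) + partialSumsTotal P

  ways-W-close : ∀ s I p P → ways s I (W (suc p ∷ P)) ≡ ways (p + s) I (true ∷ W P)
  ways-W-close s I p P = ways-a^k p s I (true ∷ W P)

  ways-W-self : ∀ I → IsComposition I → ways 0 I (W I) ≡ 1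
  ways-W-self []          _         = refl
  ways-W-self (suc i ∷ I) (_ ∷ isI) = begin
    ways 0 (suc i ∷ I) (W (suc i ∷ I))          ≡⟨ ways-W-close 0 (suc i ∷ I) i I ⟩
    ways (i + 0) (suc i ∷ I) (true ∷ W I)       ≡⟨ cong₂ (λ a b → a choose i * ways b I (W I)) (+-identityʳ i)
                                                          (trans (cong (_∸ i) (+-identityʳ i)) (n∸n≡0 i)) ⟩
    i choose i * ways 0 I (W I)                 ≡⟨ cong₂ _*_ (n-choose-n≡1 i) (ways-W-self I isI) ⟩
    1                                           ∎

  private
    weight-step : ∀ p s i L vi vp → i ≤ p + s → vi ≤ vp + (p + s ∸ i) * L →
                  suc i * suc L + vi ≤ suc p * suc L + vp + s * suc L
    weight-step p s i L vi vp i≤p+s vi≤ =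
      ≤-trans (+-monoʳ-≤ (suc i * suc L) (≤-trans vi≤ (+-monoʳ-≤ vp (*-monoʳ-≤ t (n≤1+n L)))))
              (≤-reflexive (begin
        suc i * suc L + (vp + t * suc L)    ≡⟨ regroupˡ i t L vp ⟩
        suc (i + t) * suc L + vp            ≡⟨ cong (λ x → suc x * suc L + vp) (m+[n∸m]≡n i≤p+s) ⟩
        suc (p + s) * suc L + vp            ≡⟨ regroupʳ p s L vp ⟩
        suc p * suc L + vp + s * suc L      ∎))
      where
      t = p + s ∸ i
      regroupˡ : ∀ i t L vp → suc i * suc L + (vp + t * suc L) ≡ suc (i + t) * suc L + vp
      regroupˡ = solve-∀
      regroupʳ : ∀ p s L vp → suc (p + s) * suc L + vp ≡ suc p * suc L + vp + s * suc L
      regroupʳ = solve-∀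

  ways≢0⇒partialSumsTotal≤ : ∀ s I P → IsComposition I → IsComposition P → ways s I (W P) ≢ 0 →
    partialSumsTotal I ≤ partialSumsTotal P + s * length P × length I ≡ length P
  ways≢0⇒partialSumsTotal≤ s I           []          _         _         ≢0 with accept≢0 s I ≢0
  ... | refl , refl = z≤n , refl
  ways≢0⇒partialSumsTotal≤ s []          (suc p ∷ P) _         _         ≢0 = ⊥-elim (≢0 (ways-W-close s [] p P))
  ways≢0⇒partialSumsTotal≤ s (suc i ∷ I) (suc p ∷ P) (_ ∷ isI) (_ ∷ isP) ≢0
    with ways-close≢0 (p + s) (suc i) I (W P) (≢0 ∘ trans (ways-W-close s (suc i ∷ I) p P))
  ... | i≤p+s , rest≢0 with ways≢0⇒partialSumsTotal≤ (p + s ∸ i) I P isI isP rest≢0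
  ... | bound , |I|≡|P| =
    subst (λ L → suc i * suc L + partialSumsTotal I ≤ suc p * suc (length P) + partialSumsTotal P + s * suc (length P)) (sym |I|≡|P|)
          (weight-step p s i (length P) (partialSumsTotal I) (partialSumsTotal P) i≤p+s bound) ,
    cong suc |I|≡|P|
  ways≢0⇒partialSumsTotal≤ s (zero ∷ I)  (suc p ∷ P) (() ∷ _)  _         ≢0
  ways≢0⇒partialSumsTotal≤ s I           (zero ∷ P)  _         (() ∷ _)  ≢0

  ways≢0⇒partialSumsTotal≡⇒≡ : ∀ I P → IsComposition I → IsComposition P → ways 0 I (W P) ≢ 0 →
                                partialSumsTotal I ≡ partialSumsTotal P → I ≡ P
  ways≢0⇒partialSumsTotal≡⇒≡ I           []          _         _         ≢0 _ with accept≢0 0 I ≢0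
  ... | _ , refl = refl
  ways≢0⇒partialSumsTotal≡⇒≡ []          (suc p ∷ P) _         _         ≢0 _ = ⊥-elim (≢0 (ways-W-close 0 [] p P))
  ways≢0⇒partialSumsTotal≡⇒≡ (suc i ∷ I) (suc p ∷ P) (_ ∷ isI) (_ ∷ isP) ≢0 total≡
    with ways-close≢0 (p + 0) (suc i) I (W P) (≢0 ∘ trans (ways-W-close 0 (suc i ∷ I) p P))
  ... | i≤p+0 , rest≢0 with ways≢0⇒partialSumsTotal≤ (p + 0 ∸ i) I P isI isP rest≢0
  ... | bound , |I|≡|P| = cong₂ _∷_ (cong suc i≡p) (ways≢0⇒partialSumsTotal≡⇒≡ I P isI isP (subst (λ x → ways x I (W P) ≢ 0) t≡0 rest≢0)
                                                    (trans totalI≡ (cong (λ x → x * suc L + partialSumsTotal P) t≡0)))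
    where
    L = length P
    t = p + 0 ∸ i
    i+t≡p+0 : i + t ≡ p + 0
    i+t≡p+0 = m+[n∸m]≡n i≤p+0
    split : ∀ i t L → suc (i + t) * suc L ≡ suc i * suc L + t * suc L
    split = solve-∀
    totalI≡ : partialSumsTotal I ≡ t * suc L + partialSumsTotal P
    totalI≡ = +-cancelˡ-≡ (suc i * suc L) _ _ (begin
      suc i * suc L + partialSumsTotal I              ≡⟨ cong (λ x → suc i * suc x + partialSumsTotal I) (sym |I|≡|P|) ⟩
      suc i * suc (length I) + partialSumsTotal I     ≡⟨ total≡ ⟩
      suc p * suc L + partialSumsTotal P              ≡⟨ cong (λ x → suc x * suc L + partialSumsTotal P) (trans (sym (+-identityʳ p)) (sym i+t≡p+0)) ⟩
      suc (i + t) * suc L + partialSumsTotal P        ≡⟨ cong (_+ partialSumsTotal P) (split i t L) ⟩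
      suc i * suc L + t * suc L + partialSumsTotal P  ≡⟨ +-assoc (suc i * suc L) _ _ ⟩
      suc i * suc L + (t * suc L + partialSumsTotal P) ∎)
    t+tL≤tL : t + t * L ≤ t * L
    t+tL≤tL = +-cancelʳ-≤ (partialSumsTotal P) (t + t * L) (t * L)
      (subst₂ _≤_ (trans totalI≡ (cong (_+ partialSumsTotal P) (*-suc t L))) (+-comm (partialSumsTotal P) (t * L)) bound)
    t≡0 : t ≡ 0
    t≡0 = n≤0⇒n≡0 (+-cancelʳ-≤ (t * L) t 0 t+tL≤tL)
    i≡p : i ≡ p
    i≡p = trans (sym (+-identityʳ i)) (trans (cong (i +_) (sym t≡0)) (trans i+t≡p+0 (+-identityʳ p)))
  ways≢0⇒partialSumsTotal≡⇒≡ (zero ∷ I)  (suc p ∷ P) (() ∷ _)  _         ≢0 _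
  ways≢0⇒partialSumsTotal≡⇒≡ I           (zero ∷ P)  _         (() ∷ _)  ≢0 _

  partialSumsTotal≤size² : ∀ P → IsComposition P → partialSumsTotal P ≤ size P * size P
  partialSumsTotal≤size² P isP = ≤-trans (≤size*length P isP) (*-monoʳ-≤ (size P) (length≤size P isP))
    where
    length≤size : ∀ P → IsComposition P → length P ≤ size P
    length≤size []          _         = z≤n
    length≤size (suc p ∷ P) (_ ∷ isP) = s≤s (≤-trans (length≤size P isP) (m≤n+m (size P) p))
    ≤size*length : ∀ P → IsComposition P → partialSumsTotal P ≤ size P * length P
    ≤size*length []      _         = z≤n
    ≤size*length (p ∷ P) (_ ∷ isP) =
      ≤-trans (+-monoʳ-≤ (p * suc (length P)) (≤-trans (≤size*length P isP) (*-monoʳ-≤ (size P) (n≤1+n (length P)))))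
              (≤-reflexive (sym (*-distribʳ-+ (suc (length P)) p (size P))))

  shuffle-c-identity : ∀ I J R → IsComposition I → IsComposition J → IsCompositionOf (size I + size J) R →
    ∑ (compositions (size I + size J)) (λ K → shCoeffComp K I J * cIJ K R) ≡
    ∑ (compositions (size I)) (λ P → ∑ (compositions (size J)) (λ Q → cIJ I P * cIJ J Q * abCoeff R P Q))
  shuffle-c-identity I J R isI isJ (isR , |R|≡) = begin
    ∑ (compositions (size I + size J)) (λ K → shCoeffComp K I J * cIJ K R)
      ≡⟨ ∑-congᴬ (compositions (size I + size J))
           (All.map (λ {K} (isK , |K|≡) → cong (shCoeffComp K I J *_) (cIJ≡ways K R isK isR (trans |R|≡ (sym |K|≡))))
                    (compositions-sound _)) ⟩
    ∑ (compositions (size I + size J)) (λ K → shCoeffComp K I J * ways 0 K (W R))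
      ≡⟨ shuffle-ways I J R isI isJ ⟩
    ∑ (compositions (size I)) (λ P → ∑ (compositions (size J)) (λ Q → ways 0 I (W P) * ways 0 J (W Q) * abCoeff R P Q))
      ≡⟨ sym (∑-congᴬ (compositions (size I)) (All.map (λ {P} (isP , |P|≡) → ∑-congᴬ (compositions (size J))
               (All.map (λ {Q} (isQ , |Q|≡) → cong₂ (λ a b → a * b * abCoeff R P Q) (cIJ≡ways I P isI isP |P|≡) (cIJ≡ways J Q isJ isQ |Q|≡))
                        (compositions-sound _))) (compositions-sound _))) ⟩
    ∑ (compositions (size I)) (λ P → ∑ (compositions (size J)) (λ Q → cIJ I P * cIJ J Q * abCoeff R P Q))  ∎

  cIJ-diagonal : ∀ I → IsComposition I → cIJ I I ≡ 1
  cIJ-diagonal I isI = trans (cIJ≡ways I I isI isI refl) (ways-W-self I isI)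

  cIJ≢0⇒partialSumsTotal≤ : ∀ {n} I P → IsCompositionOf n I → IsCompositionOf n P → cIJ I P ≢ 0 →
                            partialSumsTotal I ≤ partialSumsTotal P
  cIJ≢0⇒partialSumsTotal≤ I P (isI , |I|≡n) (isP , |P|≡n) c≢0 =
    subst (partialSumsTotal I ≤_) (+-identityʳ (partialSumsTotal P))
          (proj₁ (ways≢0⇒partialSumsTotal≤ 0 I P isI isP (c≢0 ∘ trans (cIJ≡ways I P isI isP (trans |P|≡n (sym |I|≡n))))))

  cIJ≢0⇒partialSumsTotal≡⇒≡ : ∀ {n} I P → IsCompositionOf n I → IsCompositionOf n P → cIJ I P ≢ 0 →
                              partialSumsTotal I ≡ partialSumsTotal P → I ≡ P
  cIJ≢0⇒partialSumsTotal≡⇒≡ I P (isI , |I|≡n) (isP , |P|≡n) c≢0 =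
    ways≢0⇒partialSumsTotal≡⇒≡ I P isI isP (c≢0 ∘ trans (cIJ≡ways I P isI isP (trans |P|≡n (sym |I|≡n))))

  cIJ≢0⇒partialSumsTotal-above : ∀ {n m I J P Q} → IsCompositionOf n I → IsCompositionOf m J →
    IsCompositionOf n P → IsCompositionOf m Q → cIJ I P ≢ 0 → cIJ J Q ≢ 0 → P ≢ I ⊎ Q ≢ J →
    partialSumsTotal I + partialSumsTotal J < partialSumsTotal P + partialSumsTotal Q
  cIJ≢0⇒partialSumsTotal-above {I = I} {J} {P} {Q} isI isJ isP isQ cIP≢0 cJQ≢0 off =
    ≤∧≢⇒< (+-mono-≤ I≤P J≤Q) (distinct off)
    where
    I≤P = cIJ≢0⇒partialSumsTotal≤ I P isI isP cIP≢0
    J≤Q = cIJ≢0⇒partialSumsTotal≤ J Q isJ isQ cJQ≢0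
    equal-parts : ∀ {a b c d} → a ≤ c → b ≤ d → a + b ≡ c + d → a ≡ c
    equal-parts a≤c b≤d a+b≡c+d with m≤n⇒m<n∨m≡n a≤c
    ... | inj₂ a≡c = a≡c
    ... | inj₁ a<c = ⊥-elim (<-irrefl a+b≡c+d (+-mono-<-≤ a<c b≤d))
    distinct : P ≢ I ⊎ Q ≢ J → partialSumsTotal I + partialSumsTotal J ≢ partialSumsTotal P + partialSumsTotal Q
    distinct (inj₁ P≢I) sum≡ = P≢I (sym (cIJ≢0⇒partialSumsTotal≡⇒≡ I P isI isP cIP≢0 (equal-parts I≤P J≤Q sum≡)))
    distinct (inj₂ Q≢J) sum≡ = Q≢J (sym (cIJ≢0⇒partialSumsTotal≡⇒≡ J Q isJ isQ cJQ≢0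
      (equal-parts J≤Q I≤P (trans (+-comm _ (partialSumsTotal I)) (trans sum≡ (+-comm (partialSumsTotal P) _))))))

module Inversion {r ℓ} (R : CommutativeRing r ℓ) where

  open import Data.Nat as ℕ using (ℕ; zero; suc; _≤_; _<_)
  import Data.Nat.Properties as ℕ
  open import Data.List using (List; []; _∷_)
  open import Data.List.Properties using (≡-dec)
  import Data.List.Relation.Unary.All as All
  open import Data.Product using (_,_; proj₁; proj₂)
  open import Data.Sum using (_⊎_; inj₁; inj₂)
  open import Data.Empty using (⊥-elim)
  open import Relation.Nullary using (Dec; yes; no)
  import Relation.Binary.PropositionalEquality as ≡
  open ≡ using (_≡_; _≢_)
  open CommutativeRing R
  open import Algebra.Properties.Monoid.Mult +-monoid using (_×_; ×-homo-+)
  open import Algebra.Properties.Semiring.Mult semiring using (×1-homo-*)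
  open import Algebra.Properties.Ring ring using (x[y-z]≈xy-xz; -0#≈0#)
  open import Algebra.Properties.AbelianGroup +-abelianGroup using (⁻¹-∙-comm; x∙y⁻¹≈ε⇒x≈y)
  open import Algebra.Properties.CommutativeSemigroup *-commutativeSemigroup using () renaming (interchange to *-interchange)
  open import Relation.Binary.Reasoning.Setoid setoid
  open ListSum commutativeSemiring
  open Counting
  module ℕ∑ = ListSum ℕ.+-*-commutativeSemiring

  private variable
    A : Set

  fromℕ≈×1 : ∀ n → fromℕ R n ≈ n × 1#
  fromℕ≈×1 zero    = refl
  fromℕ≈×1 (suc n) = +-congˡ (fromℕ≈×1 n)

  fromℕ-+ : ∀ m n → fromℕ R (m ℕ.+ n) ≈ fromℕ R m + fromℕ R n
  fromℕ-+ m n = trans (fromℕ≈×1 (m ℕ.+ n)) (trans (×-homo-+ 1# m n) (sym (+-cong (fromℕ≈×1 m) (fromℕ≈×1 n))))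

  fromℕ-* : ∀ m n → fromℕ R (m ℕ.* n) ≈ fromℕ R m * fromℕ R n
  fromℕ-* m n = trans (fromℕ≈×1 (m ℕ.* n)) (trans (×1-homo-* m n) (sym (*-cong (fromℕ≈×1 m) (fromℕ≈×1 n))))

  fromℕ-∑ : (xs : List A) (f : A → ℕ) → fromℕ R (ℕ∑.∑ xs f) ≈ ∑ xs (λ x → fromℕ R (f x))
  fromℕ-∑ []       f = refl
  fromℕ-∑ (x ∷ xs) f = trans (fromℕ-+ (f x) _) (+-congˡ (fromℕ-∑ xs f))

  ∑-difference : (xs : List A) (f g : A → Carrier) → ∑ xs (λ x → f x - g x) ≈ ∑ xs f - ∑ xs g
  ∑-difference xs f g = trans (∑-+ xs f (λ x → - g x)) (+-congˡ (∑-neg xs))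
    where
    ∑-neg : ∀ xs → ∑ xs (λ x → - g x) ≈ - ∑ xs g
    ∑-neg []       = sym -0#≈0#
    ∑-neg (x ∷ xs) = trans (+-congˡ (∑-neg xs)) (⁻¹-∙-comm (g x) (∑ xs g))

  *-zero-⊎ : ∀ {x y} f → x ≈ 0# ⊎ y ≈ 0# → (x * y) * f ≈ 0#
  *-zero-⊎ f (inj₁ x≈0) = trans (*-congʳ (trans (*-congʳ x≈0) (zeroˡ _))) (zeroˡ f)
  *-zero-⊎ f (inj₂ y≈0) = trans (*-congʳ (trans (*-congˡ y≈0) (zeroʳ _))) (zeroˡ f)

  module _
    (v : Composition → Carrier)
    (v-shuffle : ∀ K L → IsComposition K → IsComposition L →
                 v K * v L ≈ Σ[_]_ R (compositions (size₂ K L)) (λ I → fromℕ R (shCoeffComp I K L) * v I))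
    (z : Composition → Carrier)
    (v≈∑cz : ∀ I → IsComposition I → v I ≈ Σ[_]_ R (compositions (size I)) (λ K → fromℕ R (cIJ I K) * z K))
    where

    c : Composition → Composition → Carrier
    c I P = fromℕ R (cIJ I P)

    product : Composition → Composition → Carrier
    product P Q = ∑ (compositions (size₂ P Q)) (λ K → fromℕ R (abCoeff K P Q) * z K)

    defect : Composition → Composition → Carrier
    defect P Q = z P * z Q - product P Q

    v≈∑cz′ : ∀ {n} K → IsCompositionOf n K → v K ≈ ∑ (compositions n) (λ P → c K P * z P)
    v≈∑cz′ K (isK , ≡.refl) = v≈∑cz K isK

    module _ (I J : Composition) (isI : IsComposition I) (isJ : IsComposition J) where

      private
        XI = compositions (size I)
        XJ = compositions (size J)
        XK = compositions (size₂ I J)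

      ∑∑-c-z*z≈v*v : ∑ XI (λ P → ∑ XJ (λ Q → (c I P * c J Q) * (z P * z Q))) ≈ v I * v J
      ∑∑-c-z*z≈v*v = begin
        ∑ XI (λ P → ∑ XJ (λ Q → (c I P * c J Q) * (z P * z Q)))
          ≈⟨ ∑-cong XI (λ P → ∑-cong XJ (λ Q → *-interchange (c I P) (c J Q) (z P) (z Q))) ⟩
        ∑ XI (λ P → ∑ XJ (λ Q → (c I P * z P) * (c J Q * z Q)))
          ≈⟨ sym (∑-*-∑ XI XJ (λ P → c I P * z P) (λ Q → c J Q * z Q)) ⟩
        ∑ XI (λ P → c I P * z P) * ∑ XJ (λ Q → c J Q * z Q)
          ≈⟨ sym (*-cong (v≈∑cz I isI) (v≈∑cz J isJ)) ⟩
        v I * v J  ∎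

      private
        weight : Composition → Composition → Composition → ℕ
        weight K P Q = cIJ I P ℕ.* cIJ J Q ℕ.* abCoeff K P Q

        c*c*product : ∀ {P Q} → IsCompositionOf (size I) P → IsCompositionOf (size J) Q →
                      (c I P * c J Q) * product P Q ≈ ∑ XK (λ K → fromℕ R (weight K P Q) * z K)
        c*c*product {P} {Q} (_ , |P|≡) (_ , |Q|≡) = begin
          (c I P * c J Q) * product P Q
            ≈⟨ *-congˡ (reflexive (≡.cong (λ n → ∑ (compositions n) (λ K → fromℕ R (abCoeff K P Q) * z K)) (≡.cong₂ ℕ._+_ |P|≡ |Q|≡))) ⟩
          (c I P * c J Q) * ∑ XK (λ K → fromℕ R (abCoeff K P Q) * z K)
            ≈⟨ sym (∑-*ˡ XK (c I P * c J Q) _) ⟩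
          ∑ XK (λ K → (c I P * c J Q) * (fromℕ R (abCoeff K P Q) * z K))
            ≈⟨ ∑-cong XK (λ K → trans (sym (*-assoc _ _ _))
                 (*-congʳ (sym (trans (fromℕ-* (cIJ I P ℕ.* cIJ J Q) (abCoeff K P Q)) (*-congʳ (fromℕ-* (cIJ I P) (cIJ J Q))))))) ⟩
          ∑ XK (λ K → fromℕ R (weight K P Q) * z K)  ∎

      ∑∑-c-product : ∑ XI (λ P → ∑ XJ (λ Q → (c I P * c J Q) * product P Q)) ≈
                     ∑ XK (λ K → fromℕ R (ℕ∑.∑ XI (λ P → ℕ∑.∑ XJ (λ Q → weight K P Q))) * z K)
      ∑∑-c-product = begin
        ∑ XI (λ P → ∑ XJ (λ Q → (c I P * c J Q) * product P Q))
          ≈⟨ ∑-congᴬ XI (All.map (λ isP → ∑-congᴬ XJ (All.map (c*c*product isP) (compositions-sound _))) (compositions-sound _)) ⟩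
        ∑ XI (λ P → ∑ XJ (λ Q → ∑ XK (λ K → fromℕ R (weight K P Q) * z K)))
          ≈⟨ ∑-cong XI (λ P → ∑-swap XJ XK _) ⟩
        ∑ XI (λ P → ∑ XK (λ K → ∑ XJ (λ Q → fromℕ R (weight K P Q) * z K)))
          ≈⟨ ∑-swap XI XK _ ⟩
        ∑ XK (λ K → ∑ XI (λ P → ∑ XJ (λ Q → fromℕ R (weight K P Q) * z K)))
          ≈⟨ ∑-cong XK (λ K → trans (∑-cong XI (λ P → ∑-*ʳ XJ (z K) _)) (∑-*ʳ XI (z K) _)) ⟩
        ∑ XK (λ K → ∑ XI (λ P → ∑ XJ (λ Q → fromℕ R (weight K P Q))) * z K)
          ≈⟨ ∑-cong XK (λ K → *-congʳ (sym (trans (fromℕ-∑ XI _) (∑-cong XI (λ P → fromℕ-∑ XJ _))))) ⟩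
        ∑ XK (λ K → fromℕ R (ℕ∑.∑ XI (λ P → ℕ∑.∑ XJ (λ Q → weight K P Q))) * z K)  ∎

      ∑-shuffle-c-z : ∑ XK (λ K → fromℕ R (ℕ∑.∑ XK (λ L → shCoeffComp L I J ℕ.* cIJ L K)) * z K) ≈ v I * v J
      ∑-shuffle-c-z = begin
        ∑ XK (λ K → fromℕ R (ℕ∑.∑ XK (λ L → shCoeffComp L I J ℕ.* cIJ L K)) * z K)
          ≈⟨ ∑-cong XK (λ K → trans (*-congʳ (trans (fromℕ-∑ XK _) (∑-cong XK (λ L → fromℕ-* (shCoeffComp L I J) (cIJ L K)))))
                                    (sym (∑-*ʳ XK (z K) _))) ⟩
        ∑ XK (λ K → ∑ XK (λ L → (fromℕ R (shCoeffComp L I J) * c L K) * z K))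
          ≈⟨ ∑-swap XK XK _ ⟩
        ∑ XK (λ L → ∑ XK (λ K → (fromℕ R (shCoeffComp L I J) * c L K) * z K))
          ≈⟨ ∑-cong XK (λ L → trans (∑-cong XK (λ K → *-assoc _ _ _)) (∑-*ˡ XK (fromℕ R (shCoeffComp L I J)) (λ K → c L K * z K))) ⟩
        ∑ XK (λ L → fromℕ R (shCoeffComp L I J) * ∑ XK (λ K → c L K * z K))
          ≈⟨ ∑-congᴬ XK (All.map (λ {L} isL → *-congˡ (sym (v≈∑cz′ L isL))) (compositions-sound (size₂ I J))) ⟩
        ∑ XK (λ L → fromℕ R (shCoeffComp L I J) * v L)
          ≈⟨ sym (v-shuffle I J isI isJ) ⟩
        v I * v J  ∎

      ∑∑-c-product≈v*v : ∑ XI (λ P → ∑ XJ (λ Q → (c I P * c J Q) * product P Q)) ≈ v I * v J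
      ∑∑-c-product≈v*v = begin
        ∑ XI (λ P → ∑ XJ (λ Q → (c I P * c J Q) * product P Q))
          ≈⟨ ∑∑-c-product ⟩
        ∑ XK (λ K → fromℕ R (ℕ∑.∑ XI (λ P → ℕ∑.∑ XJ (λ Q → weight K P Q))) * z K)
          ≈⟨ ∑-congᴬ XK (All.map (λ {K} isK → *-congʳ (reflexive (≡.cong (fromℕ R) (≡.sym (shuffle-c-identity I J K isI isJ isK)))))
                                 (compositions-sound _)) ⟩
        ∑ XK (λ K → fromℕ R (ℕ∑.∑ XK (λ L → shCoeffComp L I J ℕ.* cIJ L K)) * z K)
          ≈⟨ ∑-shuffle-c-z ⟩
        v I * v J  ∎

      ∑∑-c-defect : ∑ XI (λ P → ∑ XJ (λ Q → (c I P * c J Q) * defect P Q)) ≈ 0#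
      ∑∑-c-defect = begin
        ∑ XI (λ P → ∑ XJ (λ Q → (c I P * c J Q) * defect P Q))
          ≈⟨ ∑-cong XI (λ P → trans (∑-cong XJ (λ Q → x[y-z]≈xy-xz (c I P * c J Q) (z P * z Q) (product P Q))) (∑-difference XJ _ _)) ⟩
        ∑ XI (λ P → ∑ XJ (λ Q → (c I P * c J Q) * (z P * z Q)) - ∑ XJ (λ Q → (c I P * c J Q) * product P Q))
          ≈⟨ ∑-difference XI _ _ ⟩
        ∑ XI (λ P → ∑ XJ (λ Q → (c I P * c J Q) * (z P * z Q))) - ∑ XI (λ P → ∑ XJ (λ Q → (c I P * c J Q) * product P Q))
          ≈⟨ +-cong ∑∑-c-z*z≈v*v (-‿cong ∑∑-c-product≈v*v) ⟩
        v I * v J - v I * v J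
          ≈⟨ -‿inverseʳ (v I * v J) ⟩
        0#  ∎

    private
      _≟ᶜ_ : (P Q : Composition) → Dec (P ≡ Q)
      _≟ᶜ_ = ≡-dec ℕ._≟_

      δ : Composition → Composition → Carrier
      δ P I = fromℕ R ⟦ P ≟ᶜ I ⟧

      total : Composition → ℕ
      total = partialSumsTotal

    ∑-δ : ∀ {n} I → IsCompositionOf n I → ∑ (compositions n) (λ P → δ P I) ≈ 1#
    ∑-δ {n} I isI = begin
      ∑ (compositions n) (λ P → fromℕ R ⟦ P ≟ᶜ I ⟧)  ≈⟨ sym (fromℕ-∑ (compositions n) _) ⟩
      fromℕ R (ℕ∑.∑ (compositions n) (λ P → ⟦ P ≟ᶜ I ⟧))
        ≈⟨ reflexive (≡.cong (fromℕ R) (≡.trans (ℕ∑.∑-cong (compositions n) (λ P → ⟦⟧-sym _≟ᶜ_ P I)) (count-compositions n I isI))) ⟩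
      fromℕ R 1                                     ≈⟨ +-identityʳ 1# ⟩
      1#                                            ∎

    DefectsVanishAbove : ℕ → ℕ → Composition → Composition → Set _
    DefectsVanishAbove n m I J = ∀ {P Q} → IsCompositionOf n P → IsCompositionOf m Q →
                    total I ℕ.+ total J < total P ℕ.+ total Q → defect P Q ≈ 0#

    module _ {n m I J} (isI : IsCompositionOf n I) (isJ : IsCompositionOf m J) (above : DefectsVanishAbove n m I J) where

      c*c*defect-off-diagonal : ∀ {P Q} → IsCompositionOf n P → IsCompositionOf m Q → P ≢ I ⊎ Q ≢ J →
                                (c I P * c J Q) * defect P Q ≈ 0#
      c*c*defect-off-diagonal {P} {Q} isP isQ off with cIJ I P ℕ.≟ 0 | cIJ J Q ℕ.≟ 0
      ... | yes cIP≡0 | _         = *-zero-⊎ (defect P Q) (inj₁ (reflexive (≡.cong (fromℕ R) cIP≡0)))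
      ... | no _      | yes cJQ≡0 = *-zero-⊎ (defect P Q) (inj₂ (reflexive (≡.cong (fromℕ R) cJQ≡0)))
      ... | no cIP≢0  | no cJQ≢0  =
        trans (*-congˡ (above isP isQ (cIJ≢0⇒partialSumsTotal-above isI isJ isP isQ cIP≢0 cJQ≢0 off))) (zeroʳ _)

      δ*δ*defect≈c*c*defect : ∀ {P} → IsCompositionOf n P → ∀ {Q} → IsCompositionOf m Q →
                              (δ P I * δ Q J) * defect I J ≈ (c I P * c J Q) * defect P Q
      δ*δ*defect≈c*c*defect {P} isP {Q} isQ with P ≟ᶜ I | Q ≟ᶜ J
      ... | yes ≡.refl | yes ≡.refl = *-congʳ (*-cong (reflexive (≡.cong (fromℕ R) (≡.sym (cIJ-diagonal I (proj₁ isI)))))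
                                                       (reflexive (≡.cong (fromℕ R) (≡.sym (cIJ-diagonal J (proj₁ isJ))))))
      ... | no P≢I     | _          = trans (*-zero-⊎ (defect I J) (inj₁ refl)) (sym (c*c*defect-off-diagonal isP isQ (inj₁ P≢I)))
      ... | yes _      | no Q≢J     = trans (*-zero-⊎ (defect I J) (inj₂ refl)) (sym (c*c*defect-off-diagonal isP isQ (inj₂ Q≢J)))

      -- By unitriangularity of c, only the (I, J) term of ∑∑-c-defect survives.
      defect≈0-from-above : defect I J ≈ 0#
      defect≈0-from-above = begin
        defect I J
          ≈⟨ sym (trans (*-congʳ (trans (*-cong (∑-δ I isI) (∑-δ J isJ)) (*-identityˡ 1#))) (*-identityˡ (defect I J))) ⟩
        (∑ (compositions n) (λ P → δ P I) * ∑ (compositions m) (λ Q → δ Q J)) * defect I J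
          ≈⟨ trans (*-congʳ (∑-*-∑ (compositions n) (compositions m) _ _))
                   (sym (trans (∑-cong (compositions n) (λ P → ∑-*ʳ (compositions m) (defect I J) _)) (∑-*ʳ (compositions n) (defect I J) _))) ⟩
        ∑ (compositions n) (λ P → ∑ (compositions m) (λ Q → (δ P I * δ Q J) * defect I J))
          ≈⟨ ∑-congᴬ (compositions n) (All.map (λ isP → ∑-congᴬ (compositions m) (All.map (δ*δ*defect≈c*c*defect isP) (compositions-sound m)))
                                              (compositions-sound n)) ⟩
        ∑ (compositions n) (λ P → ∑ (compositions m) (λ Q → (c I P * c J Q) * defect P Q))
          ≈⟨ ≡.subst₂ (λ a b → ∑ (compositions a) (λ P → ∑ (compositions b) (λ Q → (c I P * c J Q) * defect P Q)) ≈ 0#)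
                      (proj₂ isI) (proj₂ isJ) (∑∑-c-defect I J (proj₁ isI) (proj₁ isJ)) ⟩
        0#  ∎

    -- Downward induction on total I + total J, which is at most n² + m².
    defect≈0 : ∀ k {n m} I J → IsCompositionOf n I → IsCompositionOf m J →
               n ℕ.* n ℕ.+ m ℕ.* m ≤ total I ℕ.+ total J ℕ.+ k → defect I J ≈ 0#
    defect≈0 zero    {n} {m} I J isI isJ bound = defect≈0-from-above isI isJ (λ {P} {Q} isP isQ above →
      ⊥-elim (ℕ.<-irrefl ≡.refl (ℕ.<-≤-trans above (ℕ.≤-trans (ℕ.+-mono-≤ (≤size² isP) (≤size² isQ))
                                                                (≡.subst (n ℕ.* n ℕ.+ m ℕ.* m ≤_) (ℕ.+-identityʳ _) bound)))))
      where
      ≤size² : ∀ {k P} → IsCompositionOf k P → total P ≤ k ℕ.* k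
      ≤size² {P = P} (isP , ≡.refl) = partialSumsTotal≤size² P isP
    defect≈0 (suc k) I J isI isJ bound = defect≈0-from-above isI isJ (λ {P} {Q} isP isQ above →
      defect≈0 k P Q isP isQ (ℕ.≤-trans bound (≡.subst (_≤ total P ℕ.+ total Q ℕ.+ k) (≡.sym (ℕ.+-suc _ k)) (ℕ.+-monoˡ-≤ k above))))

    z-product : ∀ I J → IsComposition I → IsComposition J → z I * z J ≈ product I J
    z-product I J isI isJ = x∙y⁻¹≈ε⇒x≈y _ _
      (defect≈0 (n ℕ.* n ℕ.+ m ℕ.* m) I J (isI , ≡.refl) (isJ , ≡.refl) (ℕ.m≤n+m _ (total I ℕ.+ total J)))
      where
      n = size I
      m = size J

mainTheorem4 : ∀ {c ℓ} (A : CommutativeRing c ℓ) →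
    let open CommutativeRing A in
    -- A is an algebra over a field of characteristic 0 (i.e. a ℚ-algebra)
    (∀ (n : ℕ) → ∃ λ y → fromℕ A (suc n) * y ≈ 1#) →
    -- v I = V*_I : the basis dual to (V_I); since Δ V_I is the unshuffle,
    -- its product is the shuffle:  V*_K V*_L = Σ_I ⟨I | K ⧢ L⟩ V*_I
    (v : Composition → Carrier) →
    (∀ K L → IsComposition K → IsComposition L →
       v K * v L ≈ Σ[_]_ A (compositions (size₂ K L))
                            (λ I → fromℕ A (shCoeffComp I K L) * v I)) →
    -- z I = Z_I : the basis dual to X_J = Σ_I c_{IJ} V_I, i.e.
    -- ⟨X_J , Z_I⟩ = δ_{IJ}, equivalently V*_I = Σ_K c_{IK} Z_K
    (z : Composition → Carrier) →
    (∀ I → IsComposition I →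
       v I ≈ Σ[_]_ A (compositions (size I)) (λ K → fromℕ A (cIJ I K) * z K)) →
    -- conclusion: Z_I Z_J = Σ_K ⟨W_K | W_I ⧢ W_J⟩ Z_K
    ∀ I J → IsComposition I → IsComposition J →
      z I * z J ≈ Σ[_]_ A (compositions (size₂ I J))
                          (λ K → fromℕ A (abCoeff K I J) * z K)
mainTheorem4 A _ v v-shuffle z v≈∑cz = Inversion.z-product A v v-shuffle z v≈∑cz
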